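{- Let $\mathcal S_3=\{\mathsf{ai}\downarrow,\mathsf{ai}\uparrow,\mathsf{w}\downarrow,\mathsf{w}\uparrow,\mathsf{s},\mathsf{q}\downarrow,\mathsf{q}\uparrow,\mathsf{p}\downarrow,\mathsf{p}\uparrow\}$. For every derivation in $\mathcal S_3$ from $X$ to $Y$ there are derivations of both shapes (a) $X\xrightarrow{\{\mathsf{ai}\downarrow\}}P_4\xrightarrow{\{\mathsf{w}\downarrow\}}P_5\xrightarrow{\mathsf{SNELh}}Q_5\xrightarrow{\{\mathsf{w}\uparrow\}}Q_4\xrightarrow{\{\mathsf{ai}\uparrow\}}Y$ and (b) $X\xrightarrow{\{\mathsf{w}\downarrow\}}U_4\xrightarrow{\{\mathsf{ai}\downarrow\}}U_5\xrightarrow{\mathsf{SNELh}}V_5\xrightarrow{\{\mathsf{ai}\uparrow\}}V_4\xrightarrow{\{\mathsf{w}\uparrow\}}Y$, for some intermediate structures.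
   Context: Atoms: countably many atoms $a,b,\dots$, each atom $a$ having a dual atom $\bar a$ with $\bar{\bar a}=a$. Structures are generated by $S::= a\mid \circ \mid [S,\dots,S]\mid (S,\dots,S)\mid \langle S;\dots;S\rangle \mid ?S\mid !S\mid \bar S$ (par, tensor, seq with at least one argument; unit $\circ$ not an atom), identified modulo the least congruence $=$ making par, tensor, seq associative, par and tensor commutative, $\circ$ a unit for all three, $[R]=(R)=\langle R\rangle=R$, with $\bar\circ=\circ$, $\overline{[R_1,\dots,R_h]}=(\bar R_1,\dots,\bar R_h)$, $\overline{(R_1,\dots,R_h)}=[\bar R_1,\dots,\bar R_h]$, $\overline{\langle R_1;\dots;R_h\rangle}=\langle\bar R_1;\dots;\bar R_h\rangle$, $\overline{?R}=!\bar R$, $\overline{!R}=?\bar R$, $\bar{\bar R}=R$. A context $S\{\;\}$ is a structure with one hole not under negation; $S[R,T]$ abbreviates $S\{[R,T]\}$ etc. A derivation in a rule set is a finite vertical chain of rule instances (each conclusion equal modulo $=$ to the next premise), possibly a single structure; top = premise, bottom = conclusion. Rules (premise $\Rightarrow$ conclusion): $\mathsf{ai}\downarrow$: $S\{\circ\}\Rightarrow S[a,\bar a]$; $\mathsf{ai}\uparrow$: $S(a,\bar a)\Rightarrow S\{\circ\}$; $\mathsf{s}$: $S([R,U],T)\Rightarrow S[(R,T),U]$; $\mathsf{q}\downarrow$: $S\langle[R,U];[T,V]\rangle\Rightarrow S[\langle R;T\rangle,\langle U;V\rangle]$; $\mathsf{q}\uparrow$: $S(\langle R;U\rangle,\langle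 T;V\rangle)\Rightarrow S\langle(R,T);(U,V)\rangle$; $\mathsf{p}\downarrow$: $S\{![R,T]\}\Rightarrow S[!R,?T]$; $\mathsf{p}\uparrow$: $S(?R,!T)\Rightarrow S\{?(R,T)\}$; $\mathsf{w}\downarrow$: $S\{\circ\}\Rightarrow S\{?R\}$; $\mathsf{w}\uparrow$: $S\{!R\}\Rightarrow S\{\circ\}$. $\mathsf{SNELh}=\{\mathsf{s},\mathsf{q}\downarrow,\mathsf{q}\uparrow,\mathsf{p}\downarrow,\mathsf{p}\uparrow\}$. Notation $X_0\xrightarrow{\mathcal X_1}X_1\xrightarrow{\mathcal X_2}\cdots\xrightarrow{\mathcal X_k}X_k$ denotes a derivation from $X_0$ to $X_k$ obtained by stacking, for each $i$, a derivation from $X_{i-1}$ to $X_i$ using only rules of $\mathcal X_i$ (possibly with no rule instance). -}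

module Defs where

open import Data.Nat using (ℕ)
open import Data.Bool using (Bool; not)
open import Data.Product using (_×_; _,_; Σ-syntax)
open import Relation.Binary.PropositionalEquality using (_≡_)

Atom : Set
Atom = ℕ × Bool

dual : Atom → Atom
dual (n , b) = (n , not b)

-- Structures (n-ary par/tensor/seq are represented by binary ones plus
-- associativity and unit laws of the congruence below).
infixr 6 [_,_] ⟨_⨾_⟩
infixr 7 ⦅_,_⦆
data Str : Set where
  atom   : Atom → Str
  ◦      : Str
  [_,_]  : Str → Str → Str
  ⦅_,_⦆  : Str → Str → Str
  ⟨_⨾_⟩  : Str → Str → Str
  ¿_     : Str → Str
  !_     : Str → Str
  neg    : Str → Str

infix 4 _≈_
data _≈_ : Str → Str → Set where
  ≈-refl  : ∀ {R} → R ≈ R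
  ≈-sym   : ∀ {R T} → R ≈ T → T ≈ R
  ≈-trans : ∀ {R T U} → R ≈ T → T ≈ U → R ≈ U
  par-cong  : ∀ {R R' T T'} → R ≈ R' → T ≈ T' → [ R , T ] ≈ [ R' , T' ]
  tens-cong : ∀ {R R' T T'} → R ≈ R' → T ≈ T' → ⦅ R , T ⦆ ≈ ⦅ R' , T' ⦆
  seq-cong  : ∀ {R R' T T'} → R ≈ R' → T ≈ T' → ⟨ R ⨾ T ⟩ ≈ ⟨ R' ⨾ T' ⟩
  ¿-cong    : ∀ {R R'} → R ≈ R' → ¿ R ≈ ¿ R'
  !-cong    : ∀ {R R'} → R ≈ R' → ! R ≈ ! R'
  neg-cong  : ∀ {R R'} → R ≈ R' → neg R ≈ neg R'
  par-assoc  : ∀ {R T U} → [ [ R , T ] , U ] ≈ [ R , [ T , U ] ]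
  tens-assoc : ∀ {R T U} → ⦅ ⦅ R , T ⦆ , U ⦆ ≈ ⦅ R , ⦅ T , U ⦆ ⦆
  seq-assoc  : ∀ {R T U} → ⟨ ⟨ R ⨾ T ⟩ ⨾ U ⟩ ≈ ⟨ R ⨾ ⟨ T ⨾ U ⟩ ⟩
  par-comm  : ∀ {R T} → [ R , T ] ≈ [ T , R ]
  tens-comm : ∀ {R T} → ⦅ R , T ⦆ ≈ ⦅ T , R ⦆
  par-unit   : ∀ {R} → [ ◦ , R ] ≈ R
  tens-unit  : ∀ {R} → ⦅ ◦ , R ⦆ ≈ R
  seq-unitˡ  : ∀ {R} → ⟨ ◦ ⨾ R ⟩ ≈ R
  seq-unitʳ  : ∀ {R} → ⟨ R ⨾ ◦ ⟩ ≈ R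
  neg-atom : ∀ {a} → neg (atom a) ≈ atom (dual a)
  neg-unit : neg ◦ ≈ ◦
  neg-par  : ∀ {R T} → neg [ R , T ] ≈ ⦅ neg R , neg T ⦆
  neg-tens : ∀ {R T} → neg ⦅ R , T ⦆ ≈ [ neg R , neg T ]
  neg-seq  : ∀ {R T} → neg ⟨ R ⨾ T ⟩ ≈ ⟨ neg R ⨾ neg T ⟩
  neg-¿    : ∀ {R} → neg (¿ R) ≈ ! (neg R)
  neg-!    : ∀ {R} → neg (! R) ≈ ¿ (neg R)
  neg-neg  : ∀ {R} → neg (neg R) ≈ R

-- Contexts: one hole, not under negation.
data Ctx : Set where
  hole  : Ctx
  parL  : Ctx → Str → Ctx
  parR  : Str → Ctx → Ctx
  tensL : Ctx → Str → Ctx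
  tensR : Str → Ctx → Ctx
  seqL  : Ctx → Str → Ctx
  seqR  : Str → Ctx → Ctx
  ¿C    : Ctx → Ctx
  !C    : Ctx → Ctx

infix 9 _⟦_⟧
_⟦_⟧ : Ctx → Str → Str
hole      ⟦ R ⟧ = R
parL K S  ⟦ R ⟧ = [ K ⟦ R ⟧ , S ]
parR S K  ⟦ R ⟧ = [ S , K ⟦ R ⟧ ]
tensL K S ⟦ R ⟧ = ⦅ K ⟦ R ⟧ , S ⦆
tensR S K ⟦ R ⟧ = ⦅ S , K ⟦ R ⟧ ⦆
seqL K S  ⟦ R ⟧ = ⟨ K ⟦ R ⟧ ⨾ S ⟩
seqR S K  ⟦ R ⟧ = ⟨ S ⨾ K ⟦ R ⟧ ⟩
¿C K      ⟦ R ⟧ = ¿ (K ⟦ R ⟧)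
!C K      ⟦ R ⟧ = ! (K ⟦ R ⟧)

data Rule : Set where
  ai↓ ai↑ s q↓ q↑ p↓ p↑ w↓ w↑ : Rule

-- Rule instances: Inst r premise conclusion.
data Inst : Rule → Str → Str → Set where
  ai↓-inst : ∀ K a → Inst ai↓ (K ⟦ ◦ ⟧) (K ⟦ [ atom a , atom (dual a) ] ⟧)
  ai↑-inst : ∀ K a → Inst ai↑ (K ⟦ ⦅ atom a , atom (dual a) ⦆ ⟧) (K ⟦ ◦ ⟧)
  s-inst   : ∀ K R T U → Inst s (K ⟦ ⦅ [ R , U ] , T ⦆ ⟧) (K ⟦ [ ⦅ R , T ⦆ , U ] ⟧)
  q↓-inst  : ∀ K R T U V →
    Inst q↓ (K ⟦ ⟨ [ R , U ] ⨾ [ T , V ] ⟩ ⟧) (K ⟦ [ ⟨ R ⨾ T ⟩ , ⟨ U ⨾ V ⟩ ] ⟧)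
  q↑-inst  : ∀ K R T U V →
    Inst q↑ (K ⟦ ⦅ ⟨ R ⨾ U ⟩ , ⟨ T ⨾ V ⟩ ⦆ ⟧) (K ⟦ ⟨ ⦅ R , T ⦆ ⨾ ⦅ U , V ⦆ ⟩ ⟧)
  p↓-inst  : ∀ K R T → Inst p↓ (K ⟦ ! [ R , T ] ⟧) (K ⟦ [ ! R , ¿ T ] ⟧)
  p↑-inst  : ∀ K R T → Inst p↑ (K ⟦ ⦅ ¿ R , ! T ⦆ ⟧) (K ⟦ ¿ ⦅ R , T ⦆ ⟧)
  w↓-inst  : ∀ K R → Inst w↓ (K ⟦ ◦ ⟧) (K ⟦ ¿ R ⟧)
  w↑-inst  : ∀ K R → Inst w↑ (K ⟦ ! R ⟧) (K ⟦ ◦ ⟧)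

RuleSet : Set₁
RuleSet = Rule → Set

data Deriv (𝓡 : RuleSet) : Str → Str → Set where
  stop : ∀ {X Y} → X ≈ Y → Deriv 𝓡 X Y
  step : ∀ {X P C Y} (r : Rule) → 𝓡 r → X ≈ P → Inst r P C →
         Deriv 𝓡 C Y → Deriv 𝓡 X Y

Only : Rule → RuleSet
Only r r' = r' ≡ r

data SNELh : RuleSet where
  s∈ : SNELh s
  q↓∈ : SNELh q↓
  q↑∈ : SNELh q↑
  p↓∈ : SNELh p↓
  p↑∈ : SNELh p↑

data 𝓢₃ : RuleSet where
  ai↓∈ : 𝓢₃ ai↓
  ai↑∈ : 𝓢₃ ai↑
  w↓∈  : 𝓢₃ w↓
  w↑∈  : 𝓢₃ w↑
  s∈   : 𝓢₃ s
  q↓∈  : 𝓢₃ q↓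
  q↑∈  : 𝓢₃ q↑
  p↓∈  : 𝓢₃ p↓
  p↑∈  : 𝓢₃ p↑

ShapeA : Str → Str → Set
ShapeA X Y = Σ[ P₄ ∈ Str ] Σ[ P₅ ∈ Str ] Σ[ Q₅ ∈ Str ] Σ[ Q₄ ∈ Str ]
  (Deriv (Only ai↓) X P₄ × Deriv (Only w↓) P₄ P₅ × Deriv SNELh P₅ Q₅ ×
   Deriv (Only w↑) Q₅ Q₄ × Deriv (Only ai↑) Q₄ Y)

ShapeB : Str → Str → Set
ShapeB X Y = Σ[ U₄ ∈ Str ] Σ[ U₅ ∈ Str ] Σ[ V₅ ∈ Str ] Σ[ V₄ ∈ Str ]
  (Deriv (Only w↓) X U₄ × Deriv (Only ai↓) U₄ U₅ × Deriv SNELh U₅ V₅ ×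
   Deriv (Only ai↑) V₅ V₄ × Deriv (Only w↑) V₄ Y)

-- The rules ai↓ and w↓ insert a fixed structure Z at an occurrence of the unit, so an instance
-- of either can be moved above a preceding instance of any other rule ρ.  Normalise the conclusion
-- of ρ to negation normal form and look at the modalities above the unit.  If there are none, insert
-- Z at the top, tensored with the whole premise, apply ρ, and bring Z into place by switch and seq.
-- Otherwise the outermost such modality survives modulo =, so it occurs in the conclusion of ρ:
-- apart from the redex (the two steps commute), inside an argument of the redex (insert Z there
-- first), created by the redex (insert Z into the matching part of the premise; a w↓ just weakens
-- by the larger structure), or around the redex (recurse into its body, which has fewer
-- modalities above the unit).
-- Bubbling the insertions upwards one rule at a time factors any derivation into insertions
-- followed by the rest; doing this for ai↓ then w↓ (or w↓ then ai↓) gives the top of both shapes.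
-- Negation reverses derivations and exchanges ↓ with ↑, so factoring the dual of the remainder in
-- the same way moves ai↑ and w↑ to the bottom.

module Submission where

open import Defs
open import Data.Bool using (Bool; true; false; not; _xor_; T)
open import Data.Bool.Properties using (xor-assoc; xor-same; xor-identityʳ; not-distribʳ-xor; not-involutive)
open import Data.Empty using (⊥)
open import Data.Nat using (ℕ; zero; suc; _<_)
open import Data.Nat.Induction using (<-rec)
open import Data.Nat.Properties using (≤-reflexive)
open import Data.Product using (_×_; _,_; Σ; proj₁; swap)
open import Data.Sum using (_⊎_; inj₁; inj₂)
open import Data.Unit using (⊤; tt)
open import Relation.Binary.PropositionalEquality using (_≡_; refl; sym; trans; cong; subst; subst₂)

≡⇒≈ : ∀ {X Y} → X ≡ Y → X ≈ Y
≡⇒≈ refl = ≈-refl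

infixr 5 _∙_
_∙_ : ∀ {X Y Z} → X ≈ Y → Y ≈ Z → X ≈ Z
_∙_ = ≈-trans

infixr 9 _∘ᶜ_
_∘ᶜ_ : Ctx → Ctx → Ctx
hole      ∘ᶜ K' = K'
parL K S  ∘ᶜ K' = parL (K ∘ᶜ K') S
parR S K  ∘ᶜ K' = parR S (K ∘ᶜ K')
tensL K S ∘ᶜ K' = tensL (K ∘ᶜ K') S
tensR S K ∘ᶜ K' = tensR S (K ∘ᶜ K')
seqL K S  ∘ᶜ K' = seqL (K ∘ᶜ K') S
seqR S K  ∘ᶜ K' = seqR S (K ∘ᶜ K')
¿C K      ∘ᶜ K' = ¿C (K ∘ᶜ K')
!C K      ∘ᶜ K' = !C (K ∘ᶜ K')

∘ᶜ-plug : ∀ K K' X → (K ∘ᶜ K') ⟦ X ⟧ ≡ K ⟦ K' ⟦ X ⟧ ⟧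
∘ᶜ-plug hole        K' X = refl
∘ᶜ-plug (parL K S)  K' X = cong [_, S ] (∘ᶜ-plug K K' X)
∘ᶜ-plug (parR S K)  K' X = cong [ S ,_] (∘ᶜ-plug K K' X)
∘ᶜ-plug (tensL K S) K' X = cong ⦅_, S ⦆ (∘ᶜ-plug K K' X)
∘ᶜ-plug (tensR S K) K' X = cong ⦅ S ,_⦆ (∘ᶜ-plug K K' X)
∘ᶜ-plug (seqL K S)  K' X = cong ⟨_⨾ S ⟩ (∘ᶜ-plug K K' X)
∘ᶜ-plug (seqR S K)  K' X = cong ⟨ S ⨾_⟩ (∘ᶜ-plug K K' X)
∘ᶜ-plug (¿C K)      K' X = cong ¿_ (∘ᶜ-plug K K' X)
∘ᶜ-plug (!C K)      K' X = cong !_ (∘ᶜ-plug K K' X)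

plug-cong : ∀ K {X Y} → X ≈ Y → K ⟦ X ⟧ ≈ K ⟦ Y ⟧
plug-cong hole        e = e
plug-cong (parL K S)  e = par-cong (plug-cong K e) ≈-refl
plug-cong (parR S K)  e = par-cong ≈-refl (plug-cong K e)
plug-cong (tensL K S) e = tens-cong (plug-cong K e) ≈-refl
plug-cong (tensR S K) e = tens-cong ≈-refl (plug-cong K e)
plug-cong (seqL K S)  e = seq-cong (plug-cong K e) ≈-refl
plug-cong (seqR S K)  e = seq-cong ≈-refl (plug-cong K e)
plug-cong (¿C K)      e = ¿-cong (plug-cong K e)
plug-cong (!C K)      e = !-cong (plug-cong K e)

data Redex : Rule → Str → Str → Set where
  ai↓r : ∀ a → Redex ai↓ ◦ [ atom a , atom (dual a) ]
  ai↑r : ∀ a → Redex ai↑ ⦅ atom a , atom (dual a) ⦆ ◦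
  sr   : ∀ R T U → Redex s ⦅ [ R , U ] , T ⦆ [ ⦅ R , T ⦆ , U ]
  q↓r  : ∀ R T U V → Redex q↓ ⟨ [ R , U ] ⨾ [ T , V ] ⟩ [ ⟨ R ⨾ T ⟩ , ⟨ U ⨾ V ⟩ ]
  q↑r  : ∀ R T U V → Redex q↑ ⦅ ⟨ R ⨾ U ⟩ , ⟨ T ⨾ V ⟩ ⦆ ⟨ ⦅ R , T ⦆ ⨾ ⦅ U , V ⦆ ⟩
  p↓r  : ∀ R T → Redex p↓ (! [ R , T ]) [ ! R , ¿ T ]
  p↑r  : ∀ R T → Redex p↑ ⦅ ¿ R , ! T ⦆ (¿ ⦅ R , T ⦆)
  w↓r  : ∀ R → Redex w↓ ◦ (¿ R)
  w↑r  : ∀ R → Redex w↑ (! R) ◦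

Redex⇒Inst : ∀ {ρ rp rc} → Redex ρ rp rc → (L : Ctx) → Inst ρ (L ⟦ rp ⟧) (L ⟦ rc ⟧)
Redex⇒Inst (ai↓r a)      L = ai↓-inst L a
Redex⇒Inst (ai↑r a)      L = ai↑-inst L a
Redex⇒Inst (sr R T U)    L = s-inst L R T U
Redex⇒Inst (q↓r R T U V) L = q↓-inst L R T U V
Redex⇒Inst (q↑r R T U V) L = q↑-inst L R T U V
Redex⇒Inst (p↓r R T)     L = p↓-inst L R T
Redex⇒Inst (p↑r R T)     L = p↑-inst L R T
Redex⇒Inst (w↓r R)       L = w↓-inst L R
Redex⇒Inst (w↑r R)       L = w↑-inst L R

record RedexIn (ρ : Rule) (P C : Str) : Set where
  constructor redexIn
  field
    ctx      : Ctx
    rp rc    : Str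
    redex    : Redex ρ rp rc
    premise≡ : P ≡ ctx ⟦ rp ⟧
    concl≡   : C ≡ ctx ⟦ rc ⟧

Inst⇒RedexIn : ∀ {ρ P C} → Inst ρ P C → RedexIn ρ P C
Inst⇒RedexIn (ai↓-inst K a)      = redexIn K _ _ (ai↓r a) refl refl
Inst⇒RedexIn (ai↑-inst K a)      = redexIn K _ _ (ai↑r a) refl refl
Inst⇒RedexIn (s-inst K R T U)    = redexIn K _ _ (sr R T U) refl refl
Inst⇒RedexIn (q↓-inst K R T U V) = redexIn K _ _ (q↓r R T U V) refl refl
Inst⇒RedexIn (q↑-inst K R T U V) = redexIn K _ _ (q↑r R T U V) refl refl
Inst⇒RedexIn (p↓-inst K R T)     = redexIn K _ _ (p↓r R T) refl refl
Inst⇒RedexIn (p↑-inst K R T)     = redexIn K _ _ (p↑r R T) refl refl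
Inst⇒RedexIn (w↓-inst K R)       = redexIn K _ _ (w↓r R) refl refl
Inst⇒RedexIn (w↑-inst K R)       = redexIn K _ _ (w↑r R) refl refl

Inst-lift : ∀ {ρ P C} (K : Ctx) → Inst ρ P C → Inst ρ (K ⟦ P ⟧) (K ⟦ C ⟧)
Inst-lift K i with Inst⇒RedexIn i
... | redexIn L rp rc r refl refl =
  subst₂ (Inst _) (∘ᶜ-plug K L rp) (∘ᶜ-plug K L rc) (Redex⇒Inst r (K ∘ᶜ L))

module _ {𝓡 : RuleSet} where

  Deriv-pre≈ : ∀ {X Y Z} → X ≈ Y → Deriv 𝓡 Y Z → Deriv 𝓡 X Z
  Deriv-pre≈ e (stop e')          = stop (e ∙ e')
  Deriv-pre≈ e (step r p e' i d) = step r p (e ∙ e') i d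

  Deriv-post≈ : ∀ {X Y Z} → Deriv 𝓡 X Y → Y ≈ Z → Deriv 𝓡 X Z
  Deriv-post≈ (stop e)         e' = stop (e ∙ e')
  Deriv-post≈ (step r p e i d) e' = step r p e i (Deriv-post≈ d e')

  infixr 5 _++_
  _++_ : ∀ {X Y Z} → Deriv 𝓡 X Y → Deriv 𝓡 Y Z → Deriv 𝓡 X Z
  stop e         ++ d' = Deriv-pre≈ e d'
  step r p e i d ++ d' = step r p e i (d ++ d')

  Deriv-lift : ∀ {X Y} (K : Ctx) → Deriv 𝓡 X Y → Deriv 𝓡 (K ⟦ X ⟧) (K ⟦ Y ⟧)
  Deriv-lift K (stop e)         = stop (plug-cong K e)
  Deriv-lift K (step r p e i d) = step r p (plug-cong K e) (Inst-lift K i) (Deriv-lift K d)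

  single : ∀ {X P C Y} (r : Rule) → 𝓡 r → X ≈ P → Inst r P C → C ≈ Y → Deriv 𝓡 X Y
  single r p e i e' = step r p e i (stop e')

Deriv-mono : ∀ {𝓡 𝓡' : RuleSet} → (∀ r → 𝓡 r → 𝓡' r) → ∀ {X Y} → Deriv 𝓡 X Y → Deriv 𝓡' X Y
Deriv-mono f (stop e)         = stop e
Deriv-mono f (step r p e i d) = step r (f r p) e i (Deriv-mono f d)

-- Negation normal form

nnf nnf-neg : Str → Str
nnf (atom a)     = atom a
nnf ◦            = ◦
nnf [ A , B ]    = [ nnf A , nnf B ]
nnf ⦅ A , B ⦆    = ⦅ nnf A , nnf B ⦆
nnf ⟨ A ⨾ B ⟩    = ⟨ nnf A ⨾ nnf B ⟩
nnf (¿ A)        = ¿ (nnf A)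
nnf (! A)        = ! (nnf A)
nnf (neg A)      = nnf-neg A
nnf-neg (atom a)  = atom (dual a)
nnf-neg ◦         = ◦
nnf-neg [ A , B ] = ⦅ nnf-neg A , nnf-neg B ⦆
nnf-neg ⦅ A , B ⦆ = [ nnf-neg A , nnf-neg B ]
nnf-neg ⟨ A ⨾ B ⟩ = ⟨ nnf-neg A ⨾ nnf-neg B ⟩
nnf-neg (¿ A)     = ! (nnf-neg A)
nnf-neg (! A)     = ¿ (nnf-neg A)
nnf-neg (neg A)   = nnf A

nnf≈ : ∀ A → nnf A ≈ A
nnf-neg≈ : ∀ A → nnf-neg A ≈ neg A
nnf≈ (atom a)  = ≈-refl
nnf≈ ◦         = ≈-refl
nnf≈ [ A , B ] = par-cong (nnf≈ A) (nnf≈ B)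
nnf≈ ⦅ A , B ⦆ = tens-cong (nnf≈ A) (nnf≈ B)
nnf≈ ⟨ A ⨾ B ⟩ = seq-cong (nnf≈ A) (nnf≈ B)
nnf≈ (¿ A)     = ¿-cong (nnf≈ A)
nnf≈ (! A)     = !-cong (nnf≈ A)
nnf≈ (neg A)   = nnf-neg≈ A
nnf-neg≈ (atom a)  = ≈-sym neg-atom
nnf-neg≈ ◦         = ≈-sym neg-unit
nnf-neg≈ [ A , B ] = tens-cong (nnf-neg≈ A) (nnf-neg≈ B) ∙ ≈-sym neg-par
nnf-neg≈ ⦅ A , B ⦆ = par-cong (nnf-neg≈ A) (nnf-neg≈ B) ∙ ≈-sym neg-tens
nnf-neg≈ ⟨ A ⨾ B ⟩ = seq-cong (nnf-neg≈ A) (nnf-neg≈ B) ∙ ≈-sym neg-seq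
nnf-neg≈ (¿ A)     = !-cong (nnf-neg≈ A) ∙ ≈-sym neg-¿
nnf-neg≈ (! A)     = ¿-cong (nnf-neg≈ A) ∙ ≈-sym neg-!
nnf-neg≈ (neg A)   = nnf≈ A ∙ ≈-sym neg-neg

nnf-neg-cong : ∀ {X Y} → X ≈ Y → nnf-neg X ≈ nnf-neg Y
nnf-neg-cong {X} {Y} e = nnf-neg≈ X ∙ neg-cong e ∙ ≈-sym (nnf-neg≈ Y)

nnf-neg-involutive : ∀ X → nnf-neg (nnf-neg X) ≈ X
nnf-neg-involutive X = nnf-neg≈ (nnf-neg X) ∙ neg-cong (nnf-neg≈ X) ∙ neg-neg

data NNF : Str → Set where
  atom : ∀ {a} → NNF (atom a)
  ◦    : NNF ◦
  par  : ∀ {A B} → NNF A → NNF B → NNF [ A , B ]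
  tens : ∀ {A B} → NNF A → NNF B → NNF ⦅ A , B ⦆
  seq  : ∀ {A B} → NNF A → NNF B → NNF ⟨ A ⨾ B ⟩
  ¿_   : ∀ {A} → NNF A → NNF (¿ A)
  !_   : ∀ {A} → NNF A → NNF (! A)

nnf-NNF : ∀ A → NNF (nnf A)
nnf-neg-NNF : ∀ A → NNF (nnf-neg A)
nnf-NNF (atom a)  = atom
nnf-NNF ◦         = ◦
nnf-NNF [ A , B ] = par (nnf-NNF A) (nnf-NNF B)
nnf-NNF ⦅ A , B ⦆ = tens (nnf-NNF A) (nnf-NNF B)
nnf-NNF ⟨ A ⨾ B ⟩ = seq (nnf-NNF A) (nnf-NNF B)
nnf-NNF (¿ A)     = ¿ nnf-NNF A
nnf-NNF (! A)     = ! nnf-NNF A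
nnf-NNF (neg A)   = nnf-neg-NNF A
nnf-neg-NNF (atom a)  = atom
nnf-neg-NNF ◦         = ◦
nnf-neg-NNF [ A , B ] = tens (nnf-neg-NNF A) (nnf-neg-NNF B)
nnf-neg-NNF ⦅ A , B ⦆ = par (nnf-neg-NNF A) (nnf-neg-NNF B)
nnf-neg-NNF ⟨ A ⨾ B ⟩ = seq (nnf-neg-NNF A) (nnf-neg-NNF B)
nnf-neg-NNF (¿ A)     = ! nnf-neg-NNF A
nnf-neg-NNF (! A)     = ¿ nnf-neg-NNF A
nnf-neg-NNF (neg A)   = nnf-NNF A

NNF-unplug : ∀ K {X} → NNF (K ⟦ X ⟧) → NNF X
NNF-unplug hole        n          = n
NNF-unplug (parL K S)  (par n _)  = NNF-unplug K n
NNF-unplug (parR S K)  (par _ n)  = NNF-unplug K n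
NNF-unplug (tensL K S) (tens n _) = NNF-unplug K n
NNF-unplug (tensR S K) (tens _ n) = NNF-unplug K n
NNF-unplug (seqL K S)  (seq n _)  = NNF-unplug K n
NNF-unplug (seqR S K)  (seq _ n)  = NNF-unplug K n
NNF-unplug (¿C K)      (¿ n)      = NNF-unplug K n
NNF-unplug (!C K)      (! n)      = NNF-unplug K n

nnfᶜ nnf-negᶜ : Ctx → Ctx
nnfᶜ hole        = hole
nnfᶜ (parL K S)  = parL (nnfᶜ K) (nnf S)
nnfᶜ (parR S K)  = parR (nnf S) (nnfᶜ K)
nnfᶜ (tensL K S) = tensL (nnfᶜ K) (nnf S)
nnfᶜ (tensR S K) = tensR (nnf S) (nnfᶜ K)
nnfᶜ (seqL K S)  = seqL (nnfᶜ K) (nnf S)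
nnfᶜ (seqR S K)  = seqR (nnf S) (nnfᶜ K)
nnfᶜ (¿C K)      = ¿C (nnfᶜ K)
nnfᶜ (!C K)      = !C (nnfᶜ K)
nnf-negᶜ hole        = hole
nnf-negᶜ (parL K S)  = tensL (nnf-negᶜ K) (nnf-neg S)
nnf-negᶜ (parR S K)  = tensR (nnf-neg S) (nnf-negᶜ K)
nnf-negᶜ (tensL K S) = parL (nnf-negᶜ K) (nnf-neg S)
nnf-negᶜ (tensR S K) = parR (nnf-neg S) (nnf-negᶜ K)
nnf-negᶜ (seqL K S)  = seqL (nnf-negᶜ K) (nnf-neg S)
nnf-negᶜ (seqR S K)  = seqR (nnf-neg S) (nnf-negᶜ K)
nnf-negᶜ (¿C K)      = !C (nnf-negᶜ K)
nnf-negᶜ (!C K)      = ¿C (nnf-negᶜ K)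

nnf-plug : ∀ K X → nnf (K ⟦ X ⟧) ≡ nnfᶜ K ⟦ nnf X ⟧
nnf-plug hole        X = refl
nnf-plug (parL K S)  X = cong [_, nnf S ] (nnf-plug K X)
nnf-plug (parR S K)  X = cong [ nnf S ,_] (nnf-plug K X)
nnf-plug (tensL K S) X = cong ⦅_, nnf S ⦆ (nnf-plug K X)
nnf-plug (tensR S K) X = cong ⦅ nnf S ,_⦆ (nnf-plug K X)
nnf-plug (seqL K S)  X = cong ⟨_⨾ nnf S ⟩ (nnf-plug K X)
nnf-plug (seqR S K)  X = cong ⟨ nnf S ⨾_⟩ (nnf-plug K X)
nnf-plug (¿C K)      X = cong ¿_ (nnf-plug K X)
nnf-plug (!C K)      X = cong !_ (nnf-plug K X)

nnf-neg-plug : ∀ K X → nnf-neg (K ⟦ X ⟧) ≡ nnf-negᶜ K ⟦ nnf-neg X ⟧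
nnf-neg-plug hole        X = refl
nnf-neg-plug (parL K S)  X = cong ⦅_, nnf-neg S ⦆ (nnf-neg-plug K X)
nnf-neg-plug (parR S K)  X = cong ⦅ nnf-neg S ,_⦆ (nnf-neg-plug K X)
nnf-neg-plug (tensL K S) X = cong [_, nnf-neg S ] (nnf-neg-plug K X)
nnf-neg-plug (tensR S K) X = cong [ nnf-neg S ,_] (nnf-neg-plug K X)
nnf-neg-plug (seqL K S)  X = cong ⟨_⨾ nnf-neg S ⟩ (nnf-neg-plug K X)
nnf-neg-plug (seqR S K)  X = cong ⟨ nnf-neg S ⨾_⟩ (nnf-neg-plug K X)
nnf-neg-plug (¿C K)      X = cong !_ (nnf-neg-plug K X)
nnf-neg-plug (!C K)      X = cong ¿_ (nnf-neg-plug K X)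

Redex-nnf : ∀ {ρ rp rc} → Redex ρ rp rc → Redex ρ (nnf rp) (nnf rc)
Redex-nnf (ai↓r a)      = ai↓r a
Redex-nnf (ai↑r a)      = ai↑r a
Redex-nnf (sr R T U)    = sr _ _ _
Redex-nnf (q↓r R T U V) = q↓r _ _ _ _
Redex-nnf (q↑r R T U V) = q↑r _ _ _ _
Redex-nnf (p↓r R T)     = p↓r _ _
Redex-nnf (p↑r R T)     = p↑r _ _
Redex-nnf (w↓r R)       = w↓r _
Redex-nnf (w↑r R)       = w↑r _

-- Modal occurrences and their invariance under =

modal : Bool → Str → Str
modal true  M = ! M
modal false M = ¿ M

modal-cong : ∀ b {M M'} → M ≈ M' → modal b M ≈ modal b M'
modal-cong true  e = !-cong e
modal-cong false e = ¿-cong e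

modalᶜ : Bool → Ctx → Ctx
modalᶜ true  K = !C K
modalᶜ false K = ¿C K

modalᶜ-plug : ∀ b K W → modalᶜ b K ⟦ W ⟧ ≡ modal b (K ⟦ W ⟧)
modalᶜ-plug true  K W = refl
modalᶜ-plug false K W = refl

data Occ : Str → Set where
  here!    : ∀ M → Occ (! M)
  here¿    : ∀ M → Occ (¿ M)
  parˡ     : ∀ {A B} → Occ A → Occ [ A , B ]
  parʳ     : ∀ {A B} → Occ B → Occ [ A , B ]
  tensˡ    : ∀ {A B} → Occ A → Occ ⦅ A , B ⦆
  tensʳ    : ∀ {A B} → Occ B → Occ ⦅ A , B ⦆
  seqˡ     : ∀ {A B} → Occ A → Occ ⟨ A ⨾ B ⟩
  seqʳ     : ∀ {A B} → Occ B → Occ ⟨ A ⨾ B ⟩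
  under¿   : ∀ {A} → Occ A → Occ (¿ A)
  under!   : ∀ {A} → Occ A → Occ (! A)
  underNeg : ∀ {A} → Occ A → Occ (neg A)

-- mode o is true for !, false for ?; negated o is the parity of the negations above o.
mode negated : ∀ {X} → Occ X → Bool
mode (here! M)    = true
mode (here¿ M)    = false
mode (parˡ o)     = mode o
mode (parʳ o)     = mode o
mode (tensˡ o)    = mode o
mode (tensʳ o)    = mode o
mode (seqˡ o)     = mode o
mode (seqʳ o)     = mode o
mode (under¿ o)   = mode o
mode (under! o)   = mode o
mode (underNeg o) = mode o
negated (here! M)    = false
negated (here¿ M)    = false
negated (parˡ o)     = negated o
negated (parʳ o)     = negated o
negated (tensˡ o)    = negated o
negated (tensʳ o)    = negated o
negated (seqˡ o)     = negated o
negated (seqʳ o)     = negated o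
negated (under¿ o)   = negated o
negated (under! o)   = negated o
negated (underNeg o) = not (negated o)

body : ∀ {X} → Occ X → Str
body (here! M)    = M
body (here¿ M)    = M
body (parˡ o)     = body o
body (parʳ o)     = body o
body (tensˡ o)    = body o
body (tensʳ o)    = body o
body (seqˡ o)     = body o
body (seqʳ o)     = body o
body (under¿ o)   = body o
body (under! o)   = body o
body (underNeg o) = body o

-- replace o W substitutes W for the whole modal subterm at o.
replace : ∀ {X} → Occ X → Str → Str
replace (here! M)            W = W
replace (here¿ M)            W = W
replace (parˡ {B = B} o)     W = [ replace o W , B ]
replace (parʳ {A = A} o)     W = [ A , replace o W ]
replace (tensˡ {B = B} o)    W = ⦅ replace o W , B ⦆
replace (tensʳ {A = A} o)    W = ⦅ A , replace o W ⦆
replace (seqˡ {B = B} o)     W = ⟨ replace o W ⨾ B ⟩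
replace (seqʳ {A = A} o)     W = ⟨ A ⨾ replace o W ⟩
replace (under¿ o)           W = ¿ (replace o W)
replace (under! o)           W = ! (replace o W)
replace (underNeg o)         W = neg (replace o W)

replace-cong : ∀ {X} (o : Occ X) {W W'} → W ≈ W' → replace o W ≈ replace o W'
replace-cong (here! M)    e = e
replace-cong (here¿ M)    e = e
replace-cong (parˡ o)     e = par-cong (replace-cong o e) ≈-refl
replace-cong (parʳ o)     e = par-cong ≈-refl (replace-cong o e)
replace-cong (tensˡ o)    e = tens-cong (replace-cong o e) ≈-refl
replace-cong (tensʳ o)    e = tens-cong ≈-refl (replace-cong o e)
replace-cong (seqˡ o)     e = seq-cong (replace-cong o e) ≈-refl
replace-cong (seqʳ o)     e = seq-cong ≈-refl (replace-cong o e)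
replace-cong (under¿ o)   e = ¿-cong (replace-cong o e)
replace-cong (under! o)   e = !-cong (replace-cong o e)
replace-cong (underNeg o) e = neg-cong (replace-cong o e)

negIf : Bool → Str → Str
negIf false W = W
negIf true  W = neg W

negIf-cong : ∀ f {W W'} → W ≈ W' → negIf f W ≈ negIf f W'
negIf-cong false e = e
negIf-cong true  e = neg-cong e

negIf-negIf : ∀ f g W → negIf f (negIf g W) ≈ negIf (f xor g) W
negIf-negIf false g     W = ≈-refl
negIf-negIf true  false W = ≈-refl
negIf-negIf true  true  W = neg-neg

negIf-involutive : ∀ f W → negIf f (negIf f W) ≈ W
negIf-involutive false W = ≈-refl
negIf-involutive true  W = neg-neg

xor-cancelˡ : ∀ f c → f xor (f xor c) ≡ c
xor-cancelˡ f c = trans (sym (xor-assoc f f c)) (cong (_xor c) (xor-same f))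

-- o' is o seen through flip extra negations, which turn a ! into a ?.
record Corresponds {X Y} (o' : Occ X) (o : Occ Y) : Set where
  constructor corr
  field
    flip      : Bool
    negated≡  : negated o' ≡ flip xor negated o
    mode≡     : mode o' ≡ flip xor mode o
    body≈     : body o' ≈ negIf flip (body o)
    replace≈  : ∀ W → replace o' (negIf flip W) ≈ replace o W

corr-trans : ∀ {X Y Z} {o'' : Occ X} {o' : Occ Y} {o : Occ Z} →
             Corresponds o'' o' → Corresponds o' o → Corresponds o'' o
corr-trans {o'' = o''} (corr f n₁ m₁ b₁ r₁) (corr g n₂ m₂ b₂ r₂) = corr (f xor g)
  (trans n₁ (trans (cong (f xor_) n₂) (sym (xor-assoc f g _))))
  (trans m₁ (trans (cong (f xor_) m₂) (sym (xor-assoc f g _))))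
  (b₁ ∙ negIf-cong f b₂ ∙ negIf-negIf f g _)
  (λ W → replace-cong o'' (≈-sym (negIf-negIf f g W)) ∙ r₁ (negIf g W) ∙ r₂ W)

corr-sym : ∀ {X Y} {o' : Occ X} {o : Occ Y} → Corresponds o' o → Corresponds o o'
corr-sym {o' = o'} (corr f n m b r) = corr f
  (sym (trans (cong (f xor_) n) (xor-cancelˡ f _)))
  (sym (trans (cong (f xor_) m) (xor-cancelˡ f _)))
  (≈-sym (negIf-cong f b ∙ negIf-involutive f _))
  (λ W → ≈-sym (replace-cong o' (≈-sym (negIf-involutive f W)) ∙ r (negIf f W)))

corr-same : ∀ {X Y} {o' : Occ X} {o : Occ Y} → negated o' ≡ negated o → mode o' ≡ mode o →
            body o' ≡ body o → (∀ W → replace o' W ≈ replace o W) → Corresponds o' o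
corr-same n m b r = corr false n m (≡⇒≈ b) r

corr-refl : ∀ {X} {o : Occ X} → Corresponds o o
corr-refl = corr-same refl refl refl (λ _ → ≈-refl)

module _ {X Y : Str} {o' : Occ X} {o : Occ Y} where
  corr-parˡ : ∀ {S S'} → Corresponds o' o → S ≈ S' → Corresponds (parˡ {B = S} o') (parˡ {B = S'} o)
  corr-parˡ (corr f n m b r) e = corr f n m b (λ W → par-cong (r W) e)
  corr-parʳ : ∀ {S S'} → Corresponds o' o → S ≈ S' → Corresponds (parʳ {A = S} o') (parʳ {A = S'} o)
  corr-parʳ (corr f n m b r) e = corr f n m b (λ W → par-cong e (r W))
  corr-tensˡ : ∀ {S S'} → Corresponds o' o → S ≈ S' → Corresponds (tensˡ {B = S} o') (tensˡ {B = S'} o)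
  corr-tensˡ (corr f n m b r) e = corr f n m b (λ W → tens-cong (r W) e)
  corr-tensʳ : ∀ {S S'} → Corresponds o' o → S ≈ S' → Corresponds (tensʳ {A = S} o') (tensʳ {A = S'} o)
  corr-tensʳ (corr f n m b r) e = corr f n m b (λ W → tens-cong e (r W))
  corr-seqˡ : ∀ {S S'} → Corresponds o' o → S ≈ S' → Corresponds (seqˡ {B = S} o') (seqˡ {B = S'} o)
  corr-seqˡ (corr f n m b r) e = corr f n m b (λ W → seq-cong (r W) e)
  corr-seqʳ : ∀ {S S'} → Corresponds o' o → S ≈ S' → Corresponds (seqʳ {A = S} o') (seqʳ {A = S'} o)
  corr-seqʳ (corr f n m b r) e = corr f n m b (λ W → seq-cong e (r W))
  corr-under¿ : Corresponds o' o → Corresponds (under¿ o') (under¿ o)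
  corr-under¿ (corr f n m b r) = corr f n m b (λ W → ¿-cong (r W))
  corr-under! : Corresponds o' o → Corresponds (under! o') (under! o)
  corr-under! (corr f n m b r) = corr f n m b (λ W → !-cong (r W))
  corr-underNeg : Corresponds o' o → Corresponds (underNeg o') (underNeg o)
  corr-underNeg (corr f n m b r) =
    corr f (trans (cong not n) (not-distribʳ-xor f _)) m b (λ W → neg-cong (r W))

Reflects : Str → Str → Set
Reflects X Y = (o : Occ Y) → Σ (Occ X) λ o' → Corresponds o' o

≈-reflects : ∀ {X Y} → X ≈ Y → Reflects X Y × Reflects Y X
≈-reflects ≈-refl = (λ o → o , corr-refl) , (λ o → o , corr-refl)
≈-reflects (≈-sym p) = swap (≈-reflects p)
≈-reflects (≈-trans p q) with ≈-reflects p | ≈-reflects q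
... | a₁ , b₁ | a₂ , b₂ =
  (λ o → let (o₁ , c₂) = a₂ o ; (o₂ , c₁) = a₁ o₁ in o₂ , corr-trans c₁ c₂) ,
  (λ o → let (o₁ , c₁) = b₁ o ; (o₂ , c₂) = b₂ o₁ in o₂ , corr-trans c₂ c₁)
≈-reflects (par-cong p q) with ≈-reflects p | ≈-reflects q
... | a₁ , b₁ | a₂ , b₂ =
  (λ { (parˡ o) → let (o' , c) = a₁ o in parˡ o' , corr-parˡ c q
     ; (parʳ o) → let (o' , c) = a₂ o in parʳ o' , corr-parʳ c p }) ,
  (λ { (parˡ o) → let (o' , c) = b₁ o in parˡ o' , corr-parˡ c (≈-sym q)
     ; (parʳ o) → let (o' , c) = b₂ o in parʳ o' , corr-parʳ c (≈-sym p) })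
≈-reflects (tens-cong p q) with ≈-reflects p | ≈-reflects q
... | a₁ , b₁ | a₂ , b₂ =
  (λ { (tensˡ o) → let (o' , c) = a₁ o in tensˡ o' , corr-tensˡ c q
     ; (tensʳ o) → let (o' , c) = a₂ o in tensʳ o' , corr-tensʳ c p }) ,
  (λ { (tensˡ o) → let (o' , c) = b₁ o in tensˡ o' , corr-tensˡ c (≈-sym q)
     ; (tensʳ o) → let (o' , c) = b₂ o in tensʳ o' , corr-tensʳ c (≈-sym p) })
≈-reflects (seq-cong p q) with ≈-reflects p | ≈-reflects q
... | a₁ , b₁ | a₂ , b₂ =
  (λ { (seqˡ o) → let (o' , c) = a₁ o in seqˡ o' , corr-seqˡ c q
     ; (seqʳ o) → let (o' , c) = a₂ o in seqʳ o' , corr-seqʳ c p }) ,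
  (λ { (seqˡ o) → let (o' , c) = b₁ o in seqˡ o' , corr-seqˡ c (≈-sym q)
     ; (seqʳ o) → let (o' , c) = b₂ o in seqʳ o' , corr-seqʳ c (≈-sym p) })
≈-reflects (¿-cong {R} {R'} p) with ≈-reflects p
... | a , b =
  (λ { (here¿ _)  → here¿ R , corr false refl refl p (λ _ → ≈-refl)
     ; (under¿ o) → let (o' , c) = a o in under¿ o' , corr-under¿ c }) ,
  (λ { (here¿ _)  → here¿ R' , corr false refl refl (≈-sym p) (λ _ → ≈-refl)
     ; (under¿ o) → let (o' , c) = b o in under¿ o' , corr-under¿ c })
≈-reflects (!-cong {R} {R'} p) with ≈-reflects p
... | a , b =
  (λ { (here! _)  → here! R , corr false refl refl p (λ _ → ≈-refl)
     ; (under! o) → let (o' , c) = a o in under! o' , corr-under! c }) ,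
  (λ { (here! _)  → here! R' , corr false refl refl (≈-sym p) (λ _ → ≈-refl)
     ; (under! o) → let (o' , c) = b o in under! o' , corr-under! c })
≈-reflects (neg-cong p) with ≈-reflects p
... | a , b = (λ { (underNeg o) → let (o' , c) = a o in underNeg o' , corr-underNeg c }) ,
              (λ { (underNeg o) → let (o' , c) = b o in underNeg o' , corr-underNeg c })
≈-reflects par-assoc =
  (λ { (parˡ o)        → parˡ (parˡ o) , corr-same refl refl refl (λ _ → par-assoc)
     ; (parʳ (parˡ o)) → parˡ (parʳ o) , corr-same refl refl refl (λ _ → par-assoc)
     ; (parʳ (parʳ o)) → parʳ o        , corr-same refl refl refl (λ _ → par-assoc) }) ,
  (λ { (parˡ (parˡ o)) → parˡ o        , corr-same refl refl refl (λ _ → ≈-sym par-assoc)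
     ; (parˡ (parʳ o)) → parʳ (parˡ o) , corr-same refl refl refl (λ _ → ≈-sym par-assoc)
     ; (parʳ o)        → parʳ (parʳ o) , corr-same refl refl refl (λ _ → ≈-sym par-assoc) })
≈-reflects tens-assoc =
  (λ { (tensˡ o)         → tensˡ (tensˡ o) , corr-same refl refl refl (λ _ → tens-assoc)
     ; (tensʳ (tensˡ o)) → tensˡ (tensʳ o) , corr-same refl refl refl (λ _ → tens-assoc)
     ; (tensʳ (tensʳ o)) → tensʳ o         , corr-same refl refl refl (λ _ → tens-assoc) }) ,
  (λ { (tensˡ (tensˡ o)) → tensˡ o         , corr-same refl refl refl (λ _ → ≈-sym tens-assoc)
     ; (tensˡ (tensʳ o)) → tensʳ (tensˡ o) , corr-same refl refl refl (λ _ → ≈-sym tens-assoc)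
     ; (tensʳ o)         → tensʳ (tensʳ o) , corr-same refl refl refl (λ _ → ≈-sym tens-assoc) })
≈-reflects seq-assoc =
  (λ { (seqˡ o)        → seqˡ (seqˡ o) , corr-same refl refl refl (λ _ → seq-assoc)
     ; (seqʳ (seqˡ o)) → seqˡ (seqʳ o) , corr-same refl refl refl (λ _ → seq-assoc)
     ; (seqʳ (seqʳ o)) → seqʳ o        , corr-same refl refl refl (λ _ → seq-assoc) }) ,
  (λ { (seqˡ (seqˡ o)) → seqˡ o        , corr-same refl refl refl (λ _ → ≈-sym seq-assoc)
     ; (seqˡ (seqʳ o)) → seqʳ (seqˡ o) , corr-same refl refl refl (λ _ → ≈-sym seq-assoc)
     ; (seqʳ o)        → seqʳ (seqʳ o) , corr-same refl refl refl (λ _ → ≈-sym seq-assoc) })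
≈-reflects par-comm =
  (λ { (parˡ o) → parʳ o , corr-same refl refl refl (λ _ → par-comm)
     ; (parʳ o) → parˡ o , corr-same refl refl refl (λ _ → par-comm) }) ,
  (λ { (parˡ o) → parʳ o , corr-same refl refl refl (λ _ → par-comm)
     ; (parʳ o) → parˡ o , corr-same refl refl refl (λ _ → par-comm) })
≈-reflects tens-comm =
  (λ { (tensˡ o) → tensʳ o , corr-same refl refl refl (λ _ → tens-comm)
     ; (tensʳ o) → tensˡ o , corr-same refl refl refl (λ _ → tens-comm) }) ,
  (λ { (tensˡ o) → tensʳ o , corr-same refl refl refl (λ _ → tens-comm)
     ; (tensʳ o) → tensˡ o , corr-same refl refl refl (λ _ → tens-comm) })
≈-reflects par-unit =
  (λ o → parʳ o , corr-same refl refl refl (λ _ → par-unit)) ,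
  (λ { (parˡ ()) ; (parʳ o) → o , corr-same refl refl refl (λ _ → ≈-sym par-unit) })
≈-reflects tens-unit =
  (λ o → tensʳ o , corr-same refl refl refl (λ _ → tens-unit)) ,
  (λ { (tensˡ ()) ; (tensʳ o) → o , corr-same refl refl refl (λ _ → ≈-sym tens-unit) })
≈-reflects seq-unitˡ =
  (λ o → seqʳ o , corr-same refl refl refl (λ _ → seq-unitˡ)) ,
  (λ { (seqˡ ()) ; (seqʳ o) → o , corr-same refl refl refl (λ _ → ≈-sym seq-unitˡ) })
≈-reflects seq-unitʳ =
  (λ o → seqˡ o , corr-same refl refl refl (λ _ → seq-unitʳ)) ,
  (λ { (seqʳ ()) ; (seqˡ o) → o , corr-same refl refl refl (λ _ → ≈-sym seq-unitʳ) })
≈-reflects neg-atom = (λ ()) , (λ { (underNeg ()) })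
≈-reflects neg-unit = (λ ()) , (λ { (underNeg ()) })
≈-reflects neg-par =
  (λ { (tensˡ (underNeg o)) → underNeg (parˡ o) , corr-same refl refl refl (λ _ → neg-par)
     ; (tensʳ (underNeg o)) → underNeg (parʳ o) , corr-same refl refl refl (λ _ → neg-par) }) ,
  (λ { (underNeg (parˡ o)) → tensˡ (underNeg o) , corr-same refl refl refl (λ _ → ≈-sym neg-par)
     ; (underNeg (parʳ o)) → tensʳ (underNeg o) , corr-same refl refl refl (λ _ → ≈-sym neg-par) })
≈-reflects neg-tens =
  (λ { (parˡ (underNeg o)) → underNeg (tensˡ o) , corr-same refl refl refl (λ _ → neg-tens)
     ; (parʳ (underNeg o)) → underNeg (tensʳ o) , corr-same refl refl refl (λ _ → neg-tens) }) ,
  (λ { (underNeg (tensˡ o)) → parˡ (underNeg o) , corr-same refl refl refl (λ _ → ≈-sym neg-tens)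
     ; (underNeg (tensʳ o)) → parʳ (underNeg o) , corr-same refl refl refl (λ _ → ≈-sym neg-tens) })
≈-reflects neg-seq =
  (λ { (seqˡ (underNeg o)) → underNeg (seqˡ o) , corr-same refl refl refl (λ _ → neg-seq)
     ; (seqʳ (underNeg o)) → underNeg (seqʳ o) , corr-same refl refl refl (λ _ → neg-seq) }) ,
  (λ { (underNeg (seqˡ o)) → seqˡ (underNeg o) , corr-same refl refl refl (λ _ → ≈-sym neg-seq)
     ; (underNeg (seqʳ o)) → seqʳ (underNeg o) , corr-same refl refl refl (λ _ → ≈-sym neg-seq) })
≈-reflects (neg-¿ {R}) =
  (λ { (here! _)             → underNeg (here¿ R) , corr true refl refl (≈-sym neg-neg) (λ _ → neg-neg)
     ; (under! (underNeg o)) → underNeg (under¿ o) , corr-same refl refl refl (λ _ → neg-¿) }) ,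
  (λ { (underNeg (here¿ _))  → here! (neg R) , corr true refl refl ≈-refl (λ _ → ≈-refl)
     ; (underNeg (under¿ o)) → under! (underNeg o) , corr-same refl refl refl (λ _ → ≈-sym neg-¿) })
≈-reflects (neg-! {R}) =
  (λ { (here¿ _)             → underNeg (here! R) , corr true refl refl (≈-sym neg-neg) (λ _ → neg-neg)
     ; (under¿ (underNeg o)) → underNeg (under! o) , corr-same refl refl refl (λ _ → neg-!) }) ,
  (λ { (underNeg (here! _))  → here¿ (neg R) , corr true refl refl ≈-refl (λ _ → ≈-refl)
     ; (underNeg (under! o)) → under¿ (underNeg o) , corr-same refl refl refl (λ _ → ≈-sym neg-!) })
≈-reflects neg-neg =
  (λ o → underNeg (underNeg o) , corr-same (not-involutive _) refl refl (λ _ → neg-neg)) ,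
  (λ { (underNeg (underNeg o)) → o , corr-same (sym (not-involutive _)) refl refl (λ _ → ≈-sym neg-neg) })

occ-at : (K : Ctx) (b : Bool) (M : Str) → Σ (Occ (K ⟦ modal b M ⟧)) λ o →
  negated o ≡ false × mode o ≡ b × body o ≡ M × (∀ W → replace o W ≡ K ⟦ W ⟧)
occ-at hole true  M = here! M , refl , refl , refl , (λ _ → refl)
occ-at hole false M = here¿ M , refl , refl , refl , (λ _ → refl)
occ-at (parL K S) b M with occ-at K b M
... | o , n , m , bo , r = parˡ o , n , m , bo , (λ W → cong [_, S ] (r W))
occ-at (parR S K) b M with occ-at K b M
... | o , n , m , bo , r = parʳ o , n , m , bo , (λ W → cong [ S ,_] (r W))
occ-at (tensL K S) b M with occ-at K b M
... | o , n , m , bo , r = tensˡ o , n , m , bo , (λ W → cong ⦅_, S ⦆ (r W))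
occ-at (tensR S K) b M with occ-at K b M
... | o , n , m , bo , r = tensʳ o , n , m , bo , (λ W → cong ⦅ S ,_⦆ (r W))
occ-at (seqL K S) b M with occ-at K b M
... | o , n , m , bo , r = seqˡ o , n , m , bo , (λ W → cong ⟨_⨾ S ⟩ (r W))
occ-at (seqR S K) b M with occ-at K b M
... | o , n , m , bo , r = seqʳ o , n , m , bo , (λ W → cong ⟨ S ⨾_⟩ (r W))
occ-at (¿C K) b M with occ-at K b M
... | o , n , m , bo , r = under¿ o , n , m , bo , (λ W → cong ¿_ (r W))
occ-at (!C K) b M with occ-at K b M
... | o , n , m , bo , r = under! o , n , m , bo , (λ W → cong !_ (r W))

NNF-unnegated : ∀ {X} → NNF X → (o : Occ X) → negated o ≡ false
NNF-unnegated (par n _)  (parˡ o)   = NNF-unnegated n o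
NNF-unnegated (par _ n)  (parʳ o)   = NNF-unnegated n o
NNF-unnegated (tens n _) (tensˡ o)  = NNF-unnegated n o
NNF-unnegated (tens _ n) (tensʳ o)  = NNF-unnegated n o
NNF-unnegated (seq n _)  (seqˡ o)   = NNF-unnegated n o
NNF-unnegated (seq _ n)  (seqʳ o)   = NNF-unnegated n o
NNF-unnegated (¿ n)      (here¿ M)  = refl
NNF-unnegated (¿ n)      (under¿ o) = NNF-unnegated n o
NNF-unnegated (! n)      (here! M)  = refl
NNF-unnegated (! n)      (under! o) = NNF-unnegated n o

occ⇒ctx : ∀ {X} → NNF X → (o : Occ X) → Σ Ctx λ K →
  X ≡ K ⟦ modal (mode o) (body o) ⟧ × (∀ W → replace o W ≡ K ⟦ W ⟧)
occ⇒ctx (par n _) (parˡ {B = S} o) with occ⇒ctx n o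
... | K , e , r = parL K S , cong [_, S ] e , (λ W → cong [_, S ] (r W))
occ⇒ctx (par _ n) (parʳ {A = S} o) with occ⇒ctx n o
... | K , e , r = parR S K , cong [ S ,_] e , (λ W → cong [ S ,_] (r W))
occ⇒ctx (tens n _) (tensˡ {B = S} o) with occ⇒ctx n o
... | K , e , r = tensL K S , cong ⦅_, S ⦆ e , (λ W → cong ⦅_, S ⦆ (r W))
occ⇒ctx (tens _ n) (tensʳ {A = S} o) with occ⇒ctx n o
... | K , e , r = tensR S K , cong ⦅ S ,_⦆ e , (λ W → cong ⦅ S ,_⦆ (r W))
occ⇒ctx (seq n _) (seqˡ {B = S} o) with occ⇒ctx n o
... | K , e , r = seqL K S , cong ⟨_⨾ S ⟩ e , (λ W → cong ⟨_⨾ S ⟩ (r W))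
occ⇒ctx (seq _ n) (seqʳ {A = S} o) with occ⇒ctx n o
... | K , e , r = seqR S K , cong ⟨ S ⨾_⟩ e , (λ W → cong ⟨ S ⨾_⟩ (r W))
occ⇒ctx (¿ n) (here¿ M) = hole , refl , (λ _ → refl)
occ⇒ctx (¿ n) (under¿ o) with occ⇒ctx n o
... | K , e , r = ¿C K , cong ¿_ e , (λ W → cong ¿_ (r W))
occ⇒ctx (! n) (here! M) = hole , refl , (λ _ → refl)
occ⇒ctx (! n) (under! o) with occ⇒ctx n o
... | K , e , r = !C K , cong !_ e , (λ W → cong !_ (r W))

-- Negation normal form rules out a flip: the corresponding occurrence is not under a negation.
find-modal : ∀ {X} K b M → NNF X → X ≈ K ⟦ modal b M ⟧ →
  Σ (Occ X) λ o → mode o ≡ b × body o ≈ M × (∀ W → replace o W ≈ K ⟦ W ⟧)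
find-modal K b M nnf e with occ-at K b M
... | o₀ , n₀ , m₀ , b₀ , r₀ with proj₁ (≈-reflects e) o₀
... | o , corr f ne me be re
  with trans (sym (xor-identityʳ f)) (trans (cong (f xor_) (sym n₀)) (trans (sym ne) (NNF-unnegated nnf o)))
... | refl = o , trans me m₀ , be ∙ ≡⇒≈ b₀ , (λ W → re W ∙ ≡⇒≈ (r₀ W))

-- A context with two holes x and y, given by its two one-hole restrictions.
record Ctx₂ : Set where
  field
    holeˣ   : Str → Ctx
    holeʸ   : Str → Ctx
    commute : ∀ x y → holeˣ y ⟦ x ⟧ ≡ holeʸ x ⟦ y ⟧

open Ctx₂

_⟦_,_⟧₂ : Ctx₂ → Str → Str → Str
H ⟦ x , y ⟧₂ = holeˣ H y ⟦ x ⟧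

infixr 9 _◂₂_
_◂₂_ : Ctx → Ctx₂ → Ctx₂
G ◂₂ H = record
  { holeˣ   = λ y → G ∘ᶜ holeˣ H y
  ; holeʸ   = λ x → G ∘ᶜ holeʸ H x
  ; commute = λ x y → trans (∘ᶜ-plug G _ x)
                        (trans (cong (G ⟦_⟧) (commute H x y)) (sym (∘ᶜ-plug G _ y)))
  }

parˣʸ parʸˣ : Ctx → Ctx → Ctx₂
parˣʸ Kx Ky = record { holeˣ = λ y → parL Kx (Ky ⟦ y ⟧) ; holeʸ = λ x → parR (Kx ⟦ x ⟧) Ky ; commute = λ _ _ → refl }
parʸˣ Kx Ky = record { holeˣ = λ y → parR (Ky ⟦ y ⟧) Kx ; holeʸ = λ x → parL Ky (Kx ⟦ x ⟧) ; commute = λ _ _ → refl }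

tensˣʸ tensʸˣ : Ctx → Ctx → Ctx₂
tensˣʸ Kx Ky = record { holeˣ = λ y → tensL Kx (Ky ⟦ y ⟧) ; holeʸ = λ x → tensR (Kx ⟦ x ⟧) Ky ; commute = λ _ _ → refl }
tensʸˣ Kx Ky = record { holeˣ = λ y → tensR (Ky ⟦ y ⟧) Kx ; holeʸ = λ x → tensL Ky (Kx ⟦ x ⟧) ; commute = λ _ _ → refl }

seqˣʸ seqʸˣ : Ctx → Ctx → Ctx₂
seqˣʸ Kx Ky = record { holeˣ = λ y → seqL Kx (Ky ⟦ y ⟧) ; holeʸ = λ x → seqR (Kx ⟦ x ⟧) Ky ; commute = λ _ _ → refl }
seqʸˣ Kx Ky = record { holeˣ = λ y → seqR (Ky ⟦ y ⟧) Kx ; holeʸ = λ x → seqL Ky (Kx ⟦ x ⟧) ; commute = λ _ _ → refl }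

data Position (L : Ctx) (X : Str) (o : Occ (L ⟦ X ⟧)) : Set where
  inside : (o₂ : Occ X) → mode o ≡ mode o₂ → body o ≡ body o₂ →
           (∀ W → replace o W ≡ L ⟦ replace o₂ W ⟧) → Position L X o
  above  : (L₀ L₁ : Ctx) → (∀ Y → L ⟦ Y ⟧ ≡ L₀ ⟦ modal (mode o) (L₁ ⟦ Y ⟧) ⟧) →
           body o ≡ L₁ ⟦ X ⟧ → (∀ W → replace o W ≡ L₀ ⟦ W ⟧) → Position L X o
  apart  : (H : Ctx₂) → (∀ Y → L ⟦ Y ⟧ ≡ H ⟦ Y , modal (mode o) (body o) ⟧₂) →
           (∀ W → replace o W ≡ H ⟦ X , W ⟧₂) → Position L X o

locate : (L : Ctx) (X : Str) (o : Occ (L ⟦ X ⟧)) → NNF (L ⟦ X ⟧) → Position L X o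
locate hole X o _ = inside o refl refl (λ _ → refl)
locate (parL L S) X (parˡ o) (par n _) with locate L X o n
... | inside o₂ m b r     = inside o₂ m b (λ W → cong [_, S ] (r W))
... | above L₀ L₁ e b r   = above (parL L₀ S) L₁ (λ Y → cong [_, S ] (e Y)) b (λ W → cong [_, S ] (r W))
... | apart H e r         = apart (parL hole S ◂₂ H) (λ Y → cong [_, S ] (e Y)) (λ W → cong [_, S ] (r W))
locate (parL L S) X (parʳ o) (par _ n) with occ⇒ctx n o
... | K , e , r = apart (parˣʸ L K) (λ Y → cong [ L ⟦ Y ⟧ ,_] e) (λ W → cong [ L ⟦ X ⟧ ,_] (r W))
locate (parR S L) X (parʳ o) (par _ n) with locate L X o n
... | inside o₂ m b r     = inside o₂ m b (λ W → cong [ S ,_] (r W))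
... | above L₀ L₁ e b r   = above (parR S L₀) L₁ (λ Y → cong [ S ,_] (e Y)) b (λ W → cong [ S ,_] (r W))
... | apart H e r         = apart (parR S hole ◂₂ H) (λ Y → cong [ S ,_] (e Y)) (λ W → cong [ S ,_] (r W))
locate (parR S L) X (parˡ o) (par n _) with occ⇒ctx n o
... | K , e , r = apart (parʸˣ L K) (λ Y → cong [_, L ⟦ Y ⟧ ] e) (λ W → cong [_, L ⟦ X ⟧ ] (r W))
locate (tensL L S) X (tensˡ o) (tens n _) with locate L X o n
... | inside o₂ m b r     = inside o₂ m b (λ W → cong ⦅_, S ⦆ (r W))
... | above L₀ L₁ e b r   = above (tensL L₀ S) L₁ (λ Y → cong ⦅_, S ⦆ (e Y)) b (λ W → cong ⦅_, S ⦆ (r W))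
... | apart H e r         = apart (tensL hole S ◂₂ H) (λ Y → cong ⦅_, S ⦆ (e Y)) (λ W → cong ⦅_, S ⦆ (r W))
locate (tensL L S) X (tensʳ o) (tens _ n) with occ⇒ctx n o
... | K , e , r = apart (tensˣʸ L K) (λ Y → cong ⦅ L ⟦ Y ⟧ ,_⦆ e) (λ W → cong ⦅ L ⟦ X ⟧ ,_⦆ (r W))
locate (tensR S L) X (tensʳ o) (tens _ n) with locate L X o n
... | inside o₂ m b r     = inside o₂ m b (λ W → cong ⦅ S ,_⦆ (r W))
... | above L₀ L₁ e b r   = above (tensR S L₀) L₁ (λ Y → cong ⦅ S ,_⦆ (e Y)) b (λ W → cong ⦅ S ,_⦆ (r W))
... | apart H e r         = apart (tensR S hole ◂₂ H) (λ Y → cong ⦅ S ,_⦆ (e Y)) (λ W → cong ⦅ S ,_⦆ (r W))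
locate (tensR S L) X (tensˡ o) (tens n _) with occ⇒ctx n o
... | K , e , r = apart (tensʸˣ L K) (λ Y → cong ⦅_, L ⟦ Y ⟧ ⦆ e) (λ W → cong ⦅_, L ⟦ X ⟧ ⦆ (r W))
locate (seqL L S) X (seqˡ o) (seq n _) with locate L X o n
... | inside o₂ m b r     = inside o₂ m b (λ W → cong ⟨_⨾ S ⟩ (r W))
... | above L₀ L₁ e b r   = above (seqL L₀ S) L₁ (λ Y → cong ⟨_⨾ S ⟩ (e Y)) b (λ W → cong ⟨_⨾ S ⟩ (r W))
... | apart H e r         = apart (seqL hole S ◂₂ H) (λ Y → cong ⟨_⨾ S ⟩ (e Y)) (λ W → cong ⟨_⨾ S ⟩ (r W))
locate (seqL L S) X (seqʳ o) (seq _ n) with occ⇒ctx n o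
... | K , e , r = apart (seqˣʸ L K) (λ Y → cong ⟨ L ⟦ Y ⟧ ⨾_⟩ e) (λ W → cong ⟨ L ⟦ X ⟧ ⨾_⟩ (r W))
locate (seqR S L) X (seqʳ o) (seq _ n) with locate L X o n
... | inside o₂ m b r     = inside o₂ m b (λ W → cong ⟨ S ⨾_⟩ (r W))
... | above L₀ L₁ e b r   = above (seqR S L₀) L₁ (λ Y → cong ⟨ S ⨾_⟩ (e Y)) b (λ W → cong ⟨ S ⨾_⟩ (r W))
... | apart H e r         = apart (seqR S hole ◂₂ H) (λ Y → cong ⟨ S ⨾_⟩ (e Y)) (λ W → cong ⟨ S ⨾_⟩ (r W))
locate (seqR S L) X (seqˡ o) (seq n _) with occ⇒ctx n o
... | K , e , r = apart (seqʸˣ L K) (λ Y → cong ⟨_⨾ L ⟦ Y ⟧ ⟩ e) (λ W → cong ⟨_⨾ L ⟦ X ⟧ ⟩ (r W))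
locate (¿C L) X (here¿ _) _ = above hole L (λ _ → refl) refl (λ _ → refl)
locate (¿C L) X (under¿ o) (¿ n) with locate L X o n
... | inside o₂ m b r     = inside o₂ m b (λ W → cong ¿_ (r W))
... | above L₀ L₁ e b r   = above (¿C L₀) L₁ (λ Y → cong ¿_ (e Y)) b (λ W → cong ¿_ (r W))
... | apart H e r         = apart (¿C hole ◂₂ H) (λ Y → cong ¿_ (e Y)) (λ W → cong ¿_ (r W))
locate (!C L) X (here! _) _ = above hole L (λ _ → refl) refl (λ _ → refl)
locate (!C L) X (under! o) (! n) with locate L X o n
... | inside o₂ m b r     = inside o₂ m b (λ W → cong !_ (r W))
... | above L₀ L₁ e b r   = above (!C L₀) L₁ (λ Y → cong !_ (e Y)) b (λ W → cong !_ (r W))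
... | apart H e r         = apart (!C hole ◂₂ H) (λ Y → cong !_ (e Y)) (λ W → cong !_ (r W))

-- Pushing a unit insertion above a rule instance

ModalFree : Ctx → Set
ModalFree hole        = ⊤
ModalFree (parL K _)  = ModalFree K
ModalFree (parR _ K)  = ModalFree K
ModalFree (tensL K _) = ModalFree K
ModalFree (tensR _ K) = ModalFree K
ModalFree (seqL K _)  = ModalFree K
ModalFree (seqR _ K)  = ModalFree K
ModalFree (¿C _)      = ⊥
ModalFree (!C _)      = ⊥

depth : Ctx → ℕ
depth hole        = zero
depth (parL K _)  = depth K
depth (parR _ K)  = depth K
depth (tensL K _) = depth K
depth (tensR _ K) = depth K
depth (seqL K _)  = depth K
depth (seqR _ K)  = depth K
depth (¿C K)      = suc (depth K)
depth (!C K)      = suc (depth K)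

data OutermostModal (K : Ctx) : Set where
  modal-free : ModalFree K → OutermostModal K
  modal-at   : (K₀ : Ctx) (b : Bool) (K₁ : Ctx) → (∀ W → K ⟦ W ⟧ ≡ K₀ ⟦ modal b (K₁ ⟦ W ⟧) ⟧) →
               depth K ≡ suc (depth K₁) → OutermostModal K

outermost-modal : (K : Ctx) → OutermostModal K
outermost-modal hole = modal-free tt
outermost-modal (parL K S) with outermost-modal K
... | modal-free mf          = modal-free mf
... | modal-at K₀ b K₁ e d   = modal-at (parL K₀ S) b K₁ (λ W → cong [_, S ] (e W)) d
outermost-modal (parR S K) with outermost-modal K
... | modal-free mf          = modal-free mf
... | modal-at K₀ b K₁ e d   = modal-at (parR S K₀) b K₁ (λ W → cong [ S ,_] (e W)) d
outermost-modal (tensL K S) with outermost-modal K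
... | modal-free mf          = modal-free mf
... | modal-at K₀ b K₁ e d   = modal-at (tensL K₀ S) b K₁ (λ W → cong ⦅_, S ⦆ (e W)) d
outermost-modal (tensR S K) with outermost-modal K
... | modal-free mf          = modal-free mf
... | modal-at K₀ b K₁ e d   = modal-at (tensR S K₀) b K₁ (λ W → cong ⦅ S ,_⦆ (e W)) d
outermost-modal (seqL K S) with outermost-modal K
... | modal-free mf          = modal-free mf
... | modal-at K₀ b K₁ e d   = modal-at (seqL K₀ S) b K₁ (λ W → cong ⟨_⨾ S ⟩ (e W)) d
outermost-modal (seqR S K) with outermost-modal K
... | modal-free mf          = modal-free mf
... | modal-at K₀ b K₁ e d   = modal-at (seqR S K₀) b K₁ (λ W → cong ⟨ S ⨾_⟩ (e W)) d
outermost-modal (¿C K) = modal-at hole false K (λ _ → refl) refl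
outermost-modal (!C K) = modal-at hole true K (λ _ → refl) refl

-- Switch and seq move a tensored Z into any modality-free position.
tensor-into-hole : ∀ Z K → ModalFree K → Deriv SNELh ⦅ K ⟦ ◦ ⟧ , Z ⦆ (K ⟦ Z ⟧)
tensor-into-hole Z hole _ = stop tens-unit
tensor-into-hole Z (parL K S) mf =
  step s s∈ ≈-refl (s-inst hole (K ⟦ ◦ ⟧) Z S) (Deriv-lift (parL hole S) (tensor-into-hole Z K mf))
tensor-into-hole Z (parR S K) mf =
  step s s∈ (tens-cong par-comm ≈-refl) (s-inst hole (K ⟦ ◦ ⟧) Z S)
    (Deriv-post≈ (Deriv-lift (parL hole S) (tensor-into-hole Z K mf)) par-comm)
tensor-into-hole Z (tensL K S) mf =
  Deriv-pre≈ (tens-assoc ∙ tens-cong ≈-refl tens-comm ∙ ≈-sym tens-assoc)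
    (Deriv-lift (tensL hole S) (tensor-into-hole Z K mf))
tensor-into-hole Z (tensR S K) mf =
  Deriv-pre≈ tens-assoc (Deriv-lift (tensR S hole) (tensor-into-hole Z K mf))
tensor-into-hole Z (seqL K S) mf =
  step q↑ q↑∈ (tens-cong ≈-refl (≈-sym seq-unitʳ)) (q↑-inst hole (K ⟦ ◦ ⟧) Z S ◦)
    (Deriv-pre≈ (seq-cong ≈-refl (tens-comm ∙ tens-unit)) (Deriv-lift (seqL hole S) (tensor-into-hole Z K mf)))
tensor-into-hole Z (seqR S K) mf =
  step q↑ q↑∈ (tens-cong ≈-refl (≈-sym seq-unitˡ)) (q↑-inst hole S ◦ (K ⟦ ◦ ⟧) Z)
    (Deriv-pre≈ (seq-cong (tens-comm ∙ tens-unit) ≈-refl) (Deriv-lift (seqR S hole) (tensor-into-hole Z K mf)))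

Insertion? : Str → Str → Str → Set
Insertion? Z P P' = (Σ Ctx λ K → P ≈ K ⟦ ◦ ⟧ × P' ≈ K ⟦ Z ⟧) ⊎ (P ≈ P')

Reduction? : Rule → Str → Str → Set
Reduction? ρ P Q = (Σ Ctx λ L → Σ Str λ rp → Σ Str λ rc →
  Redex ρ rp rc × P ≈ L ⟦ rp ⟧ × L ⟦ rc ⟧ ≈ Q) ⊎ (P ≈ Q)

-- A ρ-step from P followed by inserting Z, ending in D, rearranged as: insert Z (or not), apply ρ (or not), then SNELh.
Swapped : Rule → Str → Str → Str → Set
Swapped ρ Z P D = Σ Str λ P' → Σ Str λ Q → Insertion? Z P P' × Reduction? ρ P' Q × Deriv SNELh Q D

Swapped-pre≈ : ∀ {ρ Z P P₀ D} → P₀ ≈ P → Swapped ρ Z P D → Swapped ρ Z P₀ D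
Swapped-pre≈ e (P' , Q , inj₁ (K , e₁ , e₂) , r , d) = P' , Q , inj₁ (K , e ∙ e₁ , e₂) , r , d
Swapped-pre≈ e (P' , Q , inj₂ e₁ , r , d)             = P' , Q , inj₂ (e ∙ e₁) , r , d

Swapped-post≈ : ∀ {ρ Z P D D'} → Swapped ρ Z P D → D ≈ D' → Swapped ρ Z P D'
Swapped-post≈ (P' , Q , i , r , d) e = P' , Q , i , r , Deriv-post≈ d e

Swapped-lift : ∀ {ρ Z P D} (G : Ctx) → Swapped ρ Z P D → Swapped ρ Z (G ⟦ P ⟧) (G ⟦ D ⟧)
Swapped-lift {Z = Z} G (P' , Q , i , r , d) = G ⟦ P' ⟧ , G ⟦ Q ⟧ , lift-ins i , lift-red r , Deriv-lift G d
  where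
  lift-ins : ∀ {P} → Insertion? Z P P' → Insertion? Z (G ⟦ P ⟧) (G ⟦ P' ⟧)
  lift-ins (inj₁ (K , e₁ , e₂)) = inj₁ (G ∘ᶜ K , plug-cong G e₁ ∙ ≡⇒≈ (sym (∘ᶜ-plug G K ◦)) ,
                                                 plug-cong G e₂ ∙ ≡⇒≈ (sym (∘ᶜ-plug G K Z)))
  lift-ins (inj₂ e) = inj₂ (plug-cong G e)
  lift-red : ∀ {ρ} → Reduction? ρ P' Q → Reduction? ρ (G ⟦ P' ⟧) (G ⟦ Q ⟧)
  lift-red (inj₁ (L , rp , rc , red , e₁ , e₂)) = inj₁ (G ∘ᶜ L , rp , rc , red ,
    plug-cong G e₁ ∙ ≡⇒≈ (sym (∘ᶜ-plug G L rp)) , ≡⇒≈ (∘ᶜ-plug G L rc) ∙ plug-cong G e₂)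
  lift-red (inj₂ e) = inj₂ (plug-cong G e)

Swapped-modal : ∀ {ρ Z P D} b → Swapped ρ Z P D → Swapped ρ Z (modal b P) (modal b D)
Swapped-modal true  = Swapped-lift (!C hole)
Swapped-modal false = Swapped-lift (¿C hole)

NNF-unmodal : ∀ b {X} → NNF (modal b X) → NNF X
NNF-unmodal true  (! n) = n
NNF-unmodal false (¿ n) = n

swap-in-argument : ∀ {ρ} Z K₁ b (G F : Ctx) X (o : Occ X) → NNF X →
  (∀ X' → Redex ρ (G ⟦ X' ⟧) (F ⟦ X' ⟧)) → mode o ≡ b → body o ≈ K₁ ⟦ ◦ ⟧ →
  Swapped ρ Z (G ⟦ X ⟧) (F ⟦ replace o (modal b (K₁ ⟦ Z ⟧)) ⟧)
swap-in-argument Z K₁ b G F X o n red m be with occ⇒ctx n o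
... | Kₓ , X≡ , replace≡ =
  K ⟦ Z ⟧ , F ⟦ X' ⟧ ,
  inj₁ (K , premise , ≈-refl) ,
  inj₁ (hole , G ⟦ X' ⟧ , F ⟦ X' ⟧ , red X' , ≡⇒≈ (trans (plug-K Z) (cong (G ⟦_⟧) (sym (replace≡ _)))) , ≈-refl) ,
  stop ≈-refl
  where
  X' = replace o (modal b (K₁ ⟦ Z ⟧))
  K  = G ∘ᶜ Kₓ ∘ᶜ modalᶜ b K₁
  plug-K : ∀ W → K ⟦ W ⟧ ≡ G ⟦ Kₓ ⟦ modal b (K₁ ⟦ W ⟧) ⟧ ⟧
  plug-K W = trans (∘ᶜ-plug G _ W)
               (cong (G ⟦_⟧) (trans (∘ᶜ-plug Kₓ _ W) (cong (Kₓ ⟦_⟧) (modalᶜ-plug b K₁ W))))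
  premise : G ⟦ X ⟧ ≈ K ⟦ ◦ ⟧
  premise = ≡⇒≈ (cong (G ⟦_⟧) X≡)
          ∙ plug-cong G (plug-cong Kₓ (≡⇒≈ (cong (λ c → modal c (body o)) m) ∙ modal-cong b be))
          ∙ ≡⇒≈ (sym (plug-K ◦))

swap-p↑-at-root : ∀ Z K₁ R T → NNF R → NNF T → ⦅ R , T ⦆ ≈ K₁ ⟦ ◦ ⟧ →
  Swapped p↑ Z ⦅ ¿ R , ! T ⦆ (¿ (K₁ ⟦ Z ⟧))
swap-p↑-at-root Z K₁ R T nR nT e with outermost-modal K₁
... | modal-free mf =
  _ , _ ,
  inj₁ (tensL (¿C (tensR R hole)) (! T) , tens-cong (¿-cong (≈-sym (tens-comm ∙ tens-unit))) ≈-refl , ≈-refl) ,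
  inj₁ (hole , _ , _ , p↑r ⦅ R , Z ⦆ T , ≈-refl , ≈-refl) ,
  Deriv-pre≈ (¿-cong (tens-assoc ∙ tens-cong ≈-refl tens-comm ∙ ≈-sym tens-assoc ∙ tens-cong e ≈-refl))
    (Deriv-lift (¿C hole) (tensor-into-hole Z K₁ mf))
... | modal-at K₂ c K₃ K₁≡ _ with find-modal K₂ c (K₃ ⟦ ◦ ⟧) (tens nR nT) (e ∙ ≡⇒≈ (K₁≡ ◦))
... | tensˡ oR , m , b , r =
  Swapped-post≈ (swap-in-argument Z K₃ c (tensL (¿C hole) (! T)) (¿C (tensL hole T)) R oR nR (λ X' → p↑r X' T) m b)
    (¿-cong (r _ ∙ ≡⇒≈ (sym (K₁≡ Z))))
... | tensʳ oT , m , b , r =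
  Swapped-post≈ (swap-in-argument Z K₃ c (tensR (¿ R) (!C hole)) (¿C (tensR R hole)) T oT nT (λ X' → p↑r R X') m b)
    (¿-cong (r _ ∙ ≡⇒≈ (sym (K₁≡ Z))))

swap-inside-redex : ∀ {ρ rp rc} Z (K₁ : Ctx) (b : Bool) → Redex ρ rp rc → NNF rc → (o : Occ rc) →
  mode o ≡ b → body o ≈ K₁ ⟦ ◦ ⟧ → Swapped ρ Z rp (replace o (modal b (K₁ ⟦ Z ⟧)))
swap-inside-redex Z K₁ b (ai↓r _) _ (parˡ ()) _ _
swap-inside-redex Z K₁ b (ai↓r _) _ (parʳ ()) _ _
swap-inside-redex Z K₁ b (ai↑r _) _ () _ _
swap-inside-redex Z K₁ b (w↑r _) _ () _ _
swap-inside-redex Z K₁ b (sr R T U) (par (tens nR nT) nU) (parˡ (tensˡ o)) m e =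
  swap-in-argument Z K₁ b (tensL (parL hole U) T) (parL (tensL hole T) U) R o nR (λ X' → sr X' T U) m e
swap-inside-redex Z K₁ b (sr R T U) (par (tens nR nT) nU) (parˡ (tensʳ o)) m e =
  swap-in-argument Z K₁ b (tensR [ R , U ] hole) (parL (tensR R hole) U) T o nT (λ X' → sr R X' U) m e
swap-inside-redex Z K₁ b (sr R T U) (par (tens nR nT) nU) (parʳ o) m e =
  swap-in-argument Z K₁ b (tensL (parR R hole) T) (parR ⦅ R , T ⦆ hole) U o nU (λ X' → sr R T X') m e
swap-inside-redex Z K₁ b (q↓r R T U V) (par (seq nR nT) (seq nU nV)) (parˡ (seqˡ o)) m e =
  swap-in-argument Z K₁ b (seqL (parL hole U) [ T , V ]) (parL (seqL hole T) ⟨ U ⨾ V ⟩) R o nR (λ X' → q↓r X' T U V) m e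
swap-inside-redex Z K₁ b (q↓r R T U V) (par (seq nR nT) (seq nU nV)) (parˡ (seqʳ o)) m e =
  swap-in-argument Z K₁ b (seqR [ R , U ] (parL hole V)) (parL (seqR R hole) ⟨ U ⨾ V ⟩) T o nT (λ X' → q↓r R X' U V) m e
swap-inside-redex Z K₁ b (q↓r R T U V) (par (seq nR nT) (seq nU nV)) (parʳ (seqˡ o)) m e =
  swap-in-argument Z K₁ b (seqL (parR R hole) [ T , V ]) (parR ⟨ R ⨾ T ⟩ (seqL hole V)) U o nU (λ X' → q↓r R T X' V) m e
swap-inside-redex Z K₁ b (q↓r R T U V) (par (seq nR nT) (seq nU nV)) (parʳ (seqʳ o)) m e =
  swap-in-argument Z K₁ b (seqR [ R , U ] (parR T hole)) (parR ⟨ R ⨾ T ⟩ (seqR U hole)) V o nV (λ X' → q↓r R T U X') m e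
swap-inside-redex Z K₁ b (q↑r R T U V) (seq (tens nR nT) (tens nU nV)) (seqˡ (tensˡ o)) m e =
  swap-in-argument Z K₁ b (tensL (seqL hole U) ⟨ T ⨾ V ⟩) (seqL (tensL hole T) ⦅ U , V ⦆) R o nR (λ X' → q↑r X' T U V) m e
swap-inside-redex Z K₁ b (q↑r R T U V) (seq (tens nR nT) (tens nU nV)) (seqˡ (tensʳ o)) m e =
  swap-in-argument Z K₁ b (tensR ⟨ R ⨾ U ⟩ (seqL hole V)) (seqL (tensR R hole) ⦅ U , V ⦆) T o nT (λ X' → q↑r R X' U V) m e
swap-inside-redex Z K₁ b (q↑r R T U V) (seq (tens nR nT) (tens nU nV)) (seqʳ (tensˡ o)) m e =
  swap-in-argument Z K₁ b (tensL (seqR R hole) ⟨ T ⨾ V ⟩) (seqR ⦅ R , T ⦆ (tensL hole V)) U o nU (λ X' → q↑r R T X' V) m e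
swap-inside-redex Z K₁ b (q↑r R T U V) (seq (tens nR nT) (tens nU nV)) (seqʳ (tensʳ o)) m e =
  swap-in-argument Z K₁ b (tensR ⟨ R ⨾ U ⟩ (seqR T hole)) (seqR ⦅ R , T ⦆ (tensR U hole)) V o nV (λ X' → q↑r R T U X') m e
swap-inside-redex Z K₁ .true (p↓r R T) _ (parˡ (here! .R)) refl e =
  _ , _ , inj₁ (!C (parL K₁ T) , !-cong (par-cong e ≈-refl) , ≈-refl) ,
  inj₁ (hole , _ , _ , p↓r (K₁ ⟦ Z ⟧) T , ≈-refl , ≈-refl) , stop ≈-refl
swap-inside-redex Z K₁ b (p↓r R T) (par (! nR) (¿ nT)) (parˡ (under! o)) m e =
  swap-in-argument Z K₁ b (!C (parL hole T)) (parL (!C hole) (¿ T)) R o nR (λ X' → p↓r X' T) m e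
swap-inside-redex Z K₁ .false (p↓r R T) _ (parʳ (here¿ .T)) refl e =
  _ , _ , inj₁ (!C (parR R K₁) , !-cong (par-cong ≈-refl e) , ≈-refl) ,
  inj₁ (hole , _ , _ , p↓r R (K₁ ⟦ Z ⟧) , ≈-refl , ≈-refl) , stop ≈-refl
swap-inside-redex Z K₁ b (p↓r R T) (par (! nR) (¿ nT)) (parʳ (under¿ o)) m e =
  swap-in-argument Z K₁ b (!C (parR R hole)) (parR (! R) (¿C hole)) T o nT (λ X' → p↓r R X') m e
swap-inside-redex Z K₁ .false (p↑r R T) (¿ (tens nR nT)) (here¿ _) refl e = swap-p↑-at-root Z K₁ R T nR nT e
swap-inside-redex Z K₁ b (p↑r R T) (¿ (tens nR nT)) (under¿ (tensˡ o)) m e =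
  swap-in-argument Z K₁ b (tensL (¿C hole) (! T)) (¿C (tensL hole T)) R o nR (λ X' → p↑r X' T) m e
swap-inside-redex Z K₁ b (p↑r R T) (¿ (tens nR nT)) (under¿ (tensʳ o)) m e =
  swap-in-argument Z K₁ b (tensR (¿ R) (!C hole)) (¿C (tensR R hole)) T o nT (λ X' → p↑r R X') m e
-- A weakening can directly introduce the enlarged structure, so nothing needs inserting.
swap-inside-redex Z K₁ .false (w↓r R) _ (here¿ .R) refl e =
  _ , _ , inj₂ ≈-refl , inj₁ (hole , _ , _ , w↓r (K₁ ⟦ Z ⟧) , ≈-refl , ≈-refl) , stop ≈-refl
swap-inside-redex Z K₁ b (w↓r R) _ (under¿ o) _ _ =
  _ , _ , inj₂ ≈-refl , inj₁ (hole , _ , _ , w↓r (replace o (modal b (K₁ ⟦ Z ⟧))) , ≈-refl , ≈-refl) , stop ≈-refl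


swap-apart : ∀ Z {ρ rp rc} (H : Ctx₂) b K₁ {M} → Redex ρ rp rc → M ≈ K₁ ⟦ ◦ ⟧ →
  Swapped ρ Z (H ⟦ rp , modal b M ⟧₂) (H ⟦ rc , modal b (K₁ ⟦ Z ⟧) ⟧₂)
swap-apart Z {rp = rp} {rc} H b K₁ r e =
  K ⟦ Z ⟧ , H ⟦ rc , N ⟧₂ ,
  inj₁ (K , premise , ≈-refl) ,
  inj₁ (holeˣ H N , rp , rc , r , ≡⇒≈ (trans (plug-K Z) (sym (commute H rp N))) , ≈-refl) ,
  stop ≈-refl
  where
  N = modal b (K₁ ⟦ Z ⟧)
  K = holeʸ H rp ∘ᶜ modalᶜ b K₁
  plug-K : ∀ W → K ⟦ W ⟧ ≡ holeʸ H rp ⟦ modal b (K₁ ⟦ W ⟧) ⟧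
  plug-K W = trans (∘ᶜ-plug (holeʸ H rp) (modalᶜ b K₁) W) (cong (holeʸ H rp ⟦_⟧) (modalᶜ-plug b K₁ W))
  premise : H ⟦ rp , modal b _ ⟧₂ ≈ K ⟦ ◦ ⟧
  premise = ≡⇒≈ (commute H rp _) ∙ plug-cong (holeʸ H rp) (modal-cong b e) ∙ ≡⇒≈ (sym (plug-K ◦))

-- Without modalities in the way, Z is inserted at the top and moved to its place afterwards.
swap-modal-free : ∀ Z {ρ} L K {rp rc} → Redex ρ rp rc → ModalFree K → L ⟦ rc ⟧ ≈ K ⟦ ◦ ⟧ →
  Swapped ρ Z (L ⟦ rp ⟧) (K ⟦ Z ⟧)
swap-modal-free Z L K {rp} {rc} r mf e =
  _ , _ ,
  inj₁ (tensL hole (L ⟦ rp ⟧) , ≈-sym tens-unit , ≈-refl) ,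
  inj₁ (tensR Z L , rp , rc , r , ≈-refl , ≈-refl) ,
  Deriv-pre≈ (tens-comm ∙ tens-cong e ≈-refl) (tensor-into-hole Z K mf)

SwapsAt : Str → Ctx → Set
SwapsAt Z K = ∀ {ρ} L {rp rc} → Redex ρ rp rc → NNF (L ⟦ rc ⟧) → L ⟦ rc ⟧ ≈ K ⟦ ◦ ⟧ →
  Swapped ρ Z (L ⟦ rp ⟧) (K ⟦ Z ⟧)

swap-at-occurrence : ∀ Z {ρ} L {rp rc} → Redex ρ rp rc → NNF (L ⟦ rc ⟧) → (o : Occ (L ⟦ rc ⟧)) →
  ∀ K₁ → SwapsAt Z K₁ → body o ≈ K₁ ⟦ ◦ ⟧ →
  Swapped ρ Z (L ⟦ rp ⟧) (replace o (modal (mode o) (K₁ ⟦ Z ⟧)))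
swap-at-occurrence Z L {rp} {rc} r nnf o K₁ ih body≈ with locate L rc o nnf
... | inside o₂ m b R≡ =
  Swapped-post≈ (Swapped-lift L (swap-inside-redex Z K₁ (mode o) r (NNF-unplug L nnf) o₂ (sym m) (≡⇒≈ (sym b) ∙ body≈)))
    (≡⇒≈ (sym (R≡ _)))
... | above L₀ L₁ L≡ b R≡ =
  Swapped-post≈ (Swapped-pre≈ (≡⇒≈ (L≡ rp)) (Swapped-lift L₀ (Swapped-modal (mode o)
      (ih L₁ r (NNF-unmodal (mode o) (NNF-unplug L₀ (subst NNF (L≡ rc) nnf))) (≡⇒≈ (sym b) ∙ body≈)))))
    (≡⇒≈ (sym (R≡ _)))
... | apart H L≡ R≡ =
  Swapped-post≈ (Swapped-pre≈ (≡⇒≈ (L≡ rp)) (swap-apart Z H (mode o) K₁ r body≈)) (≡⇒≈ (sym (R≡ _)))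

swap-above : ∀ Z K → SwapsAt Z K
swap-above Z K = <-rec (λ n → ∀ K → depth K ≡ n → SwapsAt Z K) by-depth (depth K) K refl
  where
  by-depth : ∀ n → (∀ {m} → m < n → ∀ K → depth K ≡ m → SwapsAt Z K) → ∀ K → depth K ≡ n → SwapsAt Z K
  by-depth _ rec K refl L r nnf e with outermost-modal K
  ... | modal-free mf = swap-modal-free Z L K r mf e
  ... | modal-at K₀ b K₁ K≡ d with find-modal K₀ b (K₁ ⟦ ◦ ⟧) nnf (e ∙ ≡⇒≈ (K≡ ◦))
  ... | o , mode≡ , body≈ , replace≈ =
    Swapped-post≈ (swap-at-occurrence Z L r nnf o K₁ (rec (≤-reflexive (sym d)) K₁ refl) body≈)
      (≡⇒≈ (cong (λ c → replace o (modal c (K₁ ⟦ Z ⟧))) mode≡) ∙ replace≈ _ ∙ ≡⇒≈ (sym (K≡ Z)))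

-- Permuting insertions to the top of a derivation

Step : RuleSet → Str → Str → Set
Step 𝓐 X Y = Σ Rule λ ρ → 𝓐 ρ × Σ Str λ P → Σ Str λ C → X ≈ P × Inst ρ P C × C ≈ Y

Step? : Rule → Str → Str → Set
Step? r X Y = X ≈ Y ⊎ Step (Only r) X Y

PermutesUp : RuleSet → Rule → Set
PermutesUp 𝓐 r = ∀ {X Y W} → Step 𝓐 X Y → Step (Only r) Y W → Σ Str λ V → Step? r X V × Deriv 𝓐 V W

UnitInsertion : Rule → Set
UnitInsertion r = ∀ {P C} → Inst r P C → Σ Ctx λ K → Σ Str λ Z →
  P ≡ K ⟦ ◦ ⟧ × C ≡ K ⟦ Z ⟧ × (∀ K' → Inst r (K' ⟦ ◦ ⟧) (K' ⟦ Z ⟧))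

ai↓-insertion : UnitInsertion ai↓
ai↓-insertion (ai↓-inst K a) = K , _ , refl , refl , (λ K' → ai↓-inst K' a)

w↓-insertion : UnitInsertion w↓
w↓-insertion (w↓-inst K R) = K , _ , refl , refl , (λ K' → w↓-inst K' R)

insertion-permutes-up : ∀ r → UnitInsertion r → ∀ 𝓐 → (∀ ρ → SNELh ρ → 𝓐 ρ) → PermutesUp 𝓐 r
insertion-permutes-up r view 𝓐 SNELh⊆𝓐 {X} {Y} {W} (ρ , ρ∈𝓐 , P , C , X≈P , i , C≈Y) (.r , refl , _ , _ , Y≈P₂ , i₂ , C₂≈W)
  with view i₂ | Inst⇒RedexIn i
... | K , Z , refl , refl , r-at | redexIn L rp rc red refl refl
  with swap-above Z K (nnfᶜ L) (Redex-nnf red) (subst NNF (nnf-plug L rc) (nnf-NNF (L ⟦ rc ⟧)))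
         (≡⇒≈ (sym (nnf-plug L rc)) ∙ nnf≈ (L ⟦ rc ⟧) ∙ C≈Y ∙ Y≈P₂)
... | P' , Q , ins , red? , d = P' , inserted ins , reduced red?
  where
  X≈ : X ≈ nnfᶜ L ⟦ nnf rp ⟧
  X≈ = X≈P ∙ ≈-sym (nnf≈ (L ⟦ rp ⟧)) ∙ ≡⇒≈ (nnf-plug L rp)
  inserted : Insertion? Z (nnfᶜ L ⟦ nnf rp ⟧) P' → Step? r X P'
  inserted (inj₁ (K' , e₁ , e₂)) = inj₂ (r , refl , _ , _ , X≈ ∙ e₁ , r-at K' , ≈-sym e₂)
  inserted (inj₂ e)              = inj₁ (X≈ ∙ e)
  rest : Deriv 𝓐 Q W
  rest = Deriv-post≈ (Deriv-mono SNELh⊆𝓐 d) C₂≈W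
  reduced : Reduction? ρ P' Q → Deriv 𝓐 P' W
  reduced (inj₁ (L' , _ , _ , red' , e₁ , e₂)) = step ρ ρ∈𝓐 e₁ (Redex⇒Inst red' L') (Deriv-pre≈ e₂ rest)
  reduced (inj₂ e)                               = Deriv-pre≈ e rest

module Separate (𝓡 𝓐 : RuleSet) (r : Rule) (split : ∀ ρ → 𝓡 ρ → ρ ≡ r ⊎ 𝓐 ρ) (permutes : PermutesUp 𝓐 r) where

  bubble-step : ∀ {X Y W} → Deriv 𝓐 X Y → Step (Only r) Y W → Σ Str λ V → Step? r X V × Deriv 𝓐 V W
  bubble-step (stop e) (r' , p , P , C , e₁ , i , e₂) = _ , inj₂ (r' , p , P , C , e ∙ e₁ , i , ≈-refl) , stop e₂
  bubble-step (step ρ p e i d) st with bubble-step d st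
  ... | _ , inj₁ e' , d' = _ , inj₁ ≈-refl , step ρ p e i (Deriv-pre≈ e' d')
  ... | _ , inj₂ s₁ , d' with permutes (ρ , p , _ , _ , e , i , ≈-refl) s₁
  ... | V , s? , d'' = V , s? , d'' ++ d'

  Step?-++ : ∀ {X V W} → Step? r X V → Deriv (Only r) V W → Deriv (Only r) X W
  Step?-++ (inj₁ e)                           d = Deriv-pre≈ e d
  Step?-++ (inj₂ (r' , p , _ , _ , e₁ , i , e₂)) d = step r' p e₁ i (Deriv-pre≈ e₂ d)

  bubble : ∀ {X Y W} → Deriv 𝓐 X Y → Deriv (Only r) Y W → Σ Str λ V → Deriv (Only r) X V × Deriv 𝓐 V W
  bubble d (stop e) = _ , stop ≈-refl , Deriv-post≈ d e
  bubble d (step r' p e i d₂) with bubble-step d (r' , p , _ , _ , e , i , ≈-refl)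
  ... | _ , s? , d₁ with bubble d₁ d₂
  ... | V , dr , da = V , Step?-++ s? dr , da

  separate : ∀ {X Y} → Deriv 𝓡 X Y → Σ Str λ X₁ → Deriv (Only r) X X₁ × Deriv 𝓐 X₁ Y
  separate (stop e) = _ , stop ≈-refl , stop e
  separate (step ρ p e i d) with separate d
  ... | X₁ , dr , da with split ρ p
  ... | inj₁ refl = X₁ , step ρ refl e i dr , da
  ... | inj₂ q with bubble (step ρ q e i (stop ≈-refl)) dr
  ... | V , dr' , da' = V , dr' , da' ++ da

-- Duality

dual-rule : Rule → Rule
dual-rule ai↓ = ai↑
dual-rule ai↑ = ai↓
dual-rule s   = s
dual-rule q↓  = q↑
dual-rule q↑  = q↓
dual-rule p↓  = p↑
dual-rule p↑  = p↓
dual-rule w↓  = w↑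
dual-rule w↑  = w↓

Redex-dual : ∀ {ρ rp rc} → Redex ρ rp rc → Redex (dual-rule ρ) (nnf-neg rc) (nnf-neg rp)
Redex-dual (ai↓r a)      = ai↑r (dual a)
Redex-dual (ai↑r a)      = ai↓r (dual a)
Redex-dual (sr R T U)    = sr (nnf-neg R) (nnf-neg U) (nnf-neg T)
Redex-dual (q↓r R T U V) = q↑r (nnf-neg R) (nnf-neg U) (nnf-neg T) (nnf-neg V)
Redex-dual (q↑r R T U V) = q↓r (nnf-neg R) (nnf-neg U) (nnf-neg T) (nnf-neg V)
Redex-dual (p↓r R T)     = p↑r (nnf-neg R) (nnf-neg T)
Redex-dual (p↑r R T)     = p↓r (nnf-neg R) (nnf-neg T)
Redex-dual (w↓r R)       = w↑r (nnf-neg R)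
Redex-dual (w↑r R)       = w↓r (nnf-neg R)

Inst-dual : ∀ {ρ P C} → Inst ρ P C → Inst (dual-rule ρ) (nnf-neg C) (nnf-neg P)
Inst-dual i with Inst⇒RedexIn i
... | redexIn L rp rc r refl refl =
  subst₂ (Inst _) (sym (nnf-neg-plug L rc)) (sym (nnf-neg-plug L rp)) (Redex⇒Inst (Redex-dual r) (nnf-negᶜ L))

Deriv-dual : ∀ {𝓡 𝓡' : RuleSet} → (∀ ρ → 𝓡 ρ → 𝓡' (dual-rule ρ)) →
             ∀ {X Y} → Deriv 𝓡 X Y → Deriv 𝓡' (nnf-neg Y) (nnf-neg X)
Deriv-dual f (stop e)         = stop (nnf-neg-cong (≈-sym e))
Deriv-dual f (step ρ p e i d) =
  Deriv-dual f d ++ single (dual-rule ρ) (f ρ p) ≈-refl (Inst-dual i) (nnf-neg-cong (≈-sym e))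

Only-dual : ∀ {r X Y} → Deriv (Only r) X Y → Deriv (Only (dual-rule r)) (nnf-neg Y) (nnf-neg X)
Only-dual = Deriv-dual (λ { _ refl → refl })

SNELh+ : Bool → Bool → Bool → Bool → RuleSet
SNELh+ a b c d ai↓ = T a
SNELh+ a b c d ai↑ = T b
SNELh+ a b c d w↓  = T c
SNELh+ a b c d w↑  = T d
SNELh+ a b c d s   = ⊤
SNELh+ a b c d q↓  = ⊤
SNELh+ a b c d q↑  = ⊤
SNELh+ a b c d p↓  = ⊤
SNELh+ a b c d p↑  = ⊤

SNELh⊆SNELh+ : ∀ {a b c d} ρ → SNELh ρ → SNELh+ a b c d ρ
SNELh⊆SNELh+ _ s∈  = tt
SNELh⊆SNELh+ _ q↓∈ = tt
SNELh⊆SNELh+ _ q↑∈ = tt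
SNELh⊆SNELh+ _ p↓∈ = tt
SNELh⊆SNELh+ _ p↑∈ = tt

SNELh+⊆SNELh : ∀ ρ → SNELh+ false false false false ρ → SNELh ρ
SNELh+⊆SNELh s  _ = s∈
SNELh+⊆SNELh q↓ _ = q↓∈
SNELh+⊆SNELh q↑ _ = q↑∈
SNELh+⊆SNELh p↓ _ = p↓∈
SNELh+⊆SNELh p↑ _ = p↑∈

𝓢₃⊆SNELh+ : ∀ ρ → 𝓢₃ ρ → SNELh+ true true true true ρ
𝓢₃⊆SNELh+ _ ai↓∈ = tt
𝓢₃⊆SNELh+ _ ai↑∈ = tt
𝓢₃⊆SNELh+ _ w↓∈  = tt
𝓢₃⊆SNELh+ _ w↑∈  = tt
𝓢₃⊆SNELh+ _ s∈   = tt
𝓢₃⊆SNELh+ _ q↓∈  = tt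
𝓢₃⊆SNELh+ _ q↑∈  = tt
𝓢₃⊆SNELh+ _ p↓∈  = tt
𝓢₃⊆SNELh+ _ p↑∈  = tt

SNELh+-dual : ∀ {a b c d} ρ → SNELh+ a b c d ρ → SNELh+ b a d c (dual-rule ρ)
SNELh+-dual ai↓ p = p
SNELh+-dual ai↑ p = p
SNELh+-dual w↓  p = p
SNELh+-dual w↑  p = p
SNELh+-dual s   p = tt
SNELh+-dual q↓  p = tt
SNELh+-dual q↑  p = tt
SNELh+-dual p↓  p = tt
SNELh+-dual p↑  p = tt

split-ai↓ : ∀ {b c d} ρ → SNELh+ true b c d ρ → ρ ≡ ai↓ ⊎ SNELh+ false b c d ρ
split-ai↓ ai↓ _ = inj₁ refl
split-ai↓ ai↑ p = inj₂ p
split-ai↓ w↓  p = inj₂ p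
split-ai↓ w↑  p = inj₂ p
split-ai↓ s   p = inj₂ p
split-ai↓ q↓  p = inj₂ p
split-ai↓ q↑  p = inj₂ p
split-ai↓ p↓  p = inj₂ p
split-ai↓ p↑  p = inj₂ p

split-w↓ : ∀ {a b d} ρ → SNELh+ a b true d ρ → ρ ≡ w↓ ⊎ SNELh+ a b false d ρ
split-w↓ ai↓ p = inj₂ p
split-w↓ ai↑ p = inj₂ p
split-w↓ w↓  _ = inj₁ refl
split-w↓ w↑  p = inj₂ p
split-w↓ s   p = inj₂ p
split-w↓ q↓  p = inj₂ p
split-w↓ q↑  p = inj₂ p
split-w↓ p↓  p = inj₂ p
split-w↓ p↑  p = inj₂ p

separate-ai↓ : ∀ {b c d X Y} → Deriv (SNELh+ true b c d) X Y →
  Σ Str λ X₁ → Deriv (Only ai↓) X X₁ × Deriv (SNELh+ false b c d) X₁ Y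
separate-ai↓ {b} {c} {d} = Separate.separate _ _ ai↓ split-ai↓
  (insertion-permutes-up ai↓ ai↓-insertion (SNELh+ false b c d) SNELh⊆SNELh+)

separate-w↓ : ∀ {a b d X Y} → Deriv (SNELh+ a b true d) X Y →
  Σ Str λ X₁ → Deriv (Only w↓) X X₁ × Deriv (SNELh+ a b false d) X₁ Y
separate-w↓ {a} {b} {d} = Separate.separate _ _ w↓ split-w↓
  (insertion-permutes-up w↓ w↓-insertion (SNELh+ a b false d) SNELh⊆SNELh+)

SNELh+-dualᴰ : ∀ {a b c d X Y} → Deriv (SNELh+ a b c d) X Y → Deriv (SNELh+ b a d c) (nnf-neg Y) (nnf-neg X)
SNELh+-dualᴰ = Deriv-dual SNELh+-dual

shapeA : ∀ X Y → Deriv 𝓢₃ X Y → ShapeA X Y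
shapeA X Y d with separate-ai↓ (Deriv-mono 𝓢₃⊆SNELh+ d)
... | P₄ , ai↓s , d₁ with separate-w↓ d₁
... | P₅ , w↓s , d₂ with separate-ai↓ (SNELh+-dualᴰ d₂)
... | V , ai↑s° , d₃ with separate-w↓ d₃
... | U , w↑s° , d₄ =
  P₄ , P₅ , nnf-neg U , nnf-neg V , ai↓s , w↓s ,
  Deriv-mono SNELh+⊆SNELh (Deriv-pre≈ (≈-sym (nnf-neg-involutive P₅)) (SNELh+-dualᴰ d₄)) ,
  Only-dual w↑s° ,
  Deriv-post≈ (Only-dual ai↑s°) (nnf-neg-involutive Y)

shapeB : ∀ X Y → Deriv 𝓢₃ X Y → ShapeB X Y
shapeB X Y d with separate-w↓ (Deriv-mono 𝓢₃⊆SNELh+ d)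
... | U₄ , w↓s , d₁ with separate-ai↓ d₁
... | U₅ , ai↓s , d₂ with separate-w↓ (SNELh+-dualᴰ d₂)
... | V , w↑s° , d₃ with separate-ai↓ d₃
... | U , ai↑s° , d₄ =
  U₄ , U₅ , nnf-neg U , nnf-neg V , w↓s , ai↓s ,
  Deriv-mono SNELh+⊆SNELh (Deriv-pre≈ (≈-sym (nnf-neg-involutive U₅)) (SNELh+-dualᴰ d₄)) ,
  Only-dual ai↑s° ,
  Deriv-post≈ (Only-dual w↑s°) (nnf-neg-involutive Y)

lemma4p8 : (X Y : Str) → Deriv 𝓢₃ X Y → ShapeA X Y × ShapeB X Y
lemma4p8 X Y d = shapeA X Y d , shapeB X Y d
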